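{- For integers $k\geq 0$ write $N(m;k)$ for $N(m;(k))$, where $(k)$ is the one-row partition of $k$. Define $q_j$ by $\sum_{j\geq 0} q_j x^j = \frac{e^{ -x-\frac12x^2}}{1-x}$. (a) For all $n,k\geq 0$, $$ N(n+k;k) = \sum_{j=0}^k \binom{n}{j}t_{n-j} = \sum_{j=0}^k\frac{q_j}{(k-j)!}\,t_{n+k-j}. $$ (b) Define polynomials $A_n(x)$ by $A_0(x)=1$ and $A_{n+1}(x) = A'_n(x)+(x+1)A_n(x)$ for $n\geq 0$. Then for every $n\geq 0$, $$ \sum_{k\geq 0} N(n+k;k)\,x^k = \frac{A_n(x)}{1-x}. $$ (c) Define $b_n$ by $e^{\frac 12u^2+2u}=\sum_{n\geq 0}b_n\frac{u^n}{n!}$. Then $N(n+k;k)=b_n$ whenever $0\le n\leq k$.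
   Context: A standard Young tableau (SYT) of (possibly skew) shape is a filling of the cells of the diagram by $1,2,\dots$ (each once) increasing along rows and down columns. For a partition $\alpha\vdash k$ and a fixed SYT $T$ of shape $\alpha$, $N(m;\alpha)$ denotes the number of SYT with $m$ cells containing $T$ as a subtableau (i.e. whose entries $1,\dots,k$ form exactly $T$); equivalently $N(m;\alpha)=\sum_{\lambda\vdash m}f^{\lambda/\alpha}$, with $f^{\lambda/\alpha}$ the number of SYT of skew shape $\lambda/\alpha$. $t_m$ denotes the number of involutions in the symmetric group $\mathfrak{S}_m$ ($t_0=1$; terms with negative index do not occur since they carry a zero binomial coefficient). $j!\,q_j$ equals the number of permutations of $j$ elements with no cycles of length one or two. -}

module Defs where

open import Data.Nat as ℕ using (ℕ; zero; suc; _≤_; _≤ᵇ_; _!; _∸_)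
open import Data.Nat.Properties using (_!≢0)
open import Data.Nat.Combinatorics using (_C_)
open import Data.Integer as ℤ using (ℤ; +_; -[1+_])
open import Data.Rational as ℚ using (ℚ; _/_)
open import Data.Fin using (Fin; _≟_)
open import Data.Fin.Properties using (all?)
open import Data.Vec using (Vec; []; _∷_; lookup)
open import Data.List using (List; []; _∷_; [_]; map; concatMap; filter; length; allFin)
open import Data.Nat.ListAction using (sum)
open import Data.Bool using (if_then_else_)
open import Relation.Nullary.Decidable using (Dec)
open import Relation.Binary.PropositionalEquality using (_≡_)

sumToℕ : ℕ → (ℕ → ℕ) → ℕ
sumToℕ zero    f = f 0
sumToℕ (suc k) f = sumToℕ k f ℕ.+ f (suc k)

sumToℚ : ℕ → (ℕ → ℚ) → ℚ
sumToℚ zero    f = f 0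
sumToℚ (suc k) f = sumToℚ k f ℚ.+ f (suc k)

-- Involutions: t m = #{ f : Fin m → Fin m | f ∘ f = id }
-- (functions Fin m → Fin m enumerated as vectors)

allVecs : ∀ {A : Set} (n : ℕ) → List A → List (Vec A n)
allVecs zero    xs = [ [] ]
allVecs (suc n) xs = concatMap (λ x → map (x ∷_) (allVecs n xs)) xs

IsInvolution : ∀ {m} → Vec (Fin m) m → Set
IsInvolution v = ∀ i → lookup v (lookup v i) ≡ i

isInvolution? : ∀ {m} (v : Vec (Fin m) m) → Dec (IsInvolution v)
isInvolution? v = all? (λ i → lookup v (lookup v i) ≟ i)

t : ℕ → ℕ
t m = length (filter isInvolution? (allVecs m (allFin m)))

-- Partitions as weakly decreasing lists of positive parts.
-- addables λ = list of all partitions obtained from λ by adding one cell.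

headOr0 : List ℕ → ℕ
headOr0 []      = 0
headOr0 (a ∷ _) = a

addables : List ℕ → List (List ℕ)
addables []       = [ 1 ∷ [] ]
addables (a ∷ ρ)  =
  (suc a ∷ ρ) ∷ map (a ∷_) (filter (λ μ → headOr0 μ ℕ.≤? a) (addables ρ))

-- number of saturated chains  α = λ⁰ ⋖ λ¹ ⋖ ... ⋖ λʳ  in Young's lattice
-- starting at α, i.e. the number of standard Young tableaux of skew
-- shape λʳ/α, summed over all λʳ ⊢ |α| + r.
chains : List ℕ → ℕ → ℕ
chains α zero    = 1
chains α (suc r) = sum (map (λ ν → chains ν r) (addables α))

N : ℕ → List ℕ → ℕ
N m α = if sum α ≤ᵇ m then chains α (m ∸ sum α) else 0

rowPart : ℕ → List ℕ
rowPart zero    = []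
rowPart (suc k) = suc k ∷ []

Nrow : ℕ → ℕ → ℕ
Nrow m k = N m (rowPart k)

FPSℚ : Set
FPSℚ = ℕ → ℚ

FPSℕ : Set
FPSℕ = ℕ → ℕ

ℕtoℚ : ℕ → ℚ
ℕtoℚ n = + n / 1

inv! : ℕ → ℚ
inv! n = (+ 1 / (n !)) {{n !≢0}}

mulℚ : FPSℚ → FPSℚ → FPSℚ
mulℚ f g n = sumToℚ n (λ i → f i ℚ.* g (n ∸ i))

mulℕ : FPSℕ → FPSℕ → FPSℕ
mulℕ f g n = sumToℕ n (λ i → f i ℕ.* g (n ∸ i))

oneℚ : FPSℚ
oneℚ zero    = ℚ.1ℚ
oneℚ (suc _) = ℚ.0ℚ

powℚ : FPSℚ → ℕ → FPSℚ
powℚ f zero    = oneℚ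
powℚ f (suc n) = mulℚ f (powℚ f n)

-- exp f = Σ_{n≥0} f^n / n!, for f with zero constant term
-- (then f^n has no terms of degree < n, so coefficient j only
--  receives contributions from n ≤ j)
expℚ : FPSℚ → FPSℚ
expℚ f j = sumToℚ j (λ n → inv! n ℚ.* powℚ f n j)

geomℚ : FPSℚ
geomℚ _ = ℚ.1ℚ

geomℕ : FPSℕ
geomℕ _ = 1

negXHalfX² : FPSℚ
negXHalfX² 1 = ℚ.- ℚ.1ℚ
negXHalfX² 2 = ℚ.- ℚ.½
negXHalfX² _ = ℚ.0ℚ

q : ℕ → ℚ
q = mulℚ (expℚ negXHalfX²) geomℚ

halfU²2U : FPSℚ
halfU²2U 1 = ℚ.1ℚ ℚ.+ ℚ.1ℚ
halfU²2U 2 = ℚ.½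
halfU²2U _ = ℚ.0ℚ

b : ℕ → ℚ
b n = ℕtoℚ (n !) ℚ.* expℚ halfU²2U n

-- Polynomials A_n (coefficient functions, finitely supported)
-- A_0 = 1,  A_{n+1} = A_n' + (x+1) A_n

A : ℕ → FPSℕ
A zero    zero    = 1
A zero    (suc _) = 0
A (suc n) i = suc i ℕ.* A n (suc i) ℕ.+ shift i ℕ.+ A n i
  where
  shift : ℕ → ℕ
  shift zero    = 0
  shift (suc j) = A n j

module Submission where

-- Young's lattice is a differential poset: if U adds a cell and D removes one, then D U = U D + 1.
-- Expanding the upward chains from a partition α through downward ones gives
-- chains α r = Σᵢ A r i · downChains α i, because the recurrence A (n+1) = A n ′ + (x + 1) A n is
-- D^i U = U D^i + i D^(i-1) read on coefficients. From the one-row shape (k) there is exactly one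
-- downward chain of each length i ≤ k and none beyond, so N(n+k; k) = Σ_{i ≤ k} A n i, which is (b).
-- The involution recurrence t (m+1) = t m + m t (m-1) gives A n i = C(n,i) t(n-i), the first
-- formula of (a). For n ≤ k the sum is A n (1), which satisfies the recurrence that differentiating
-- e^{u²/2+2u} gives for b n; this is (c). Finally T(x) = Σ t m x^m/m! satisfies T′ = (1 + x) T, so
-- T⁽ⁿ⁾ = A n · T and e^{-x-x²/2} T = 1; hence q · T⁽ⁿ⁾ = A n/(1 - x), whose coefficients give the
-- second formula of (a). The recurrence for t itself comes from counting maps that are involutive
-- on a duplicate-free list S and fix everything else: splitting on the image of the first element
-- of S shows that this number depends only on the length of S.

open import Defs
open import Algebra.Bundles using (CommutativeSemiring)
open import Data.Nat using (ℕ; zero; suc)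
import Data.Nat.Properties as ℕ
import Relation.Binary.PropositionalEquality as ≡

-- Taking sumTo as a parameter makes sumToℕ and sumToℚ instances on the nose, with mulℕ and mulℚ as _⋆_.
module FiniteSums
  {c ℓ} (R : CommutativeSemiring c ℓ)
  (sumTo : ℕ → (ℕ → CommutativeSemiring.Carrier R) → CommutativeSemiring.Carrier R)
  (sumTo-zero : ∀ f → CommutativeSemiring._≈_ R (sumTo 0 f) (f 0))
  (sumTo-suc : ∀ k f → CommutativeSemiring._≈_ R (sumTo (suc k) f) (CommutativeSemiring._+_ R (sumTo k f) (f (suc k))))
  where

  open CommutativeSemiring R

  open import Data.Nat using (_≤_; _<_; _≤′_; ≤′-refl; ≤′-step; _∸_; z≤n; s≤s)
  open import Data.Nat.Properties using (≤-refl; m≤n⇒m≤1+n; ≤⇒≤′; ≤′⇒≤; n∸n≡0; +-∸-assoc; m∸[m∸n]≡n; ∸-+-assoc; m+[n∸m]≡n)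
  open import Relation.Binary.PropositionalEquality as Eq using (_≡_; cong)

  open import Algebra.Properties.CommutativeSemigroup +-commutativeSemigroup using (interchange)
  open import Algebra.Properties.CommutativeSemigroup *-commutativeSemigroup using (x∙yz≈y∙xz)
  open import Relation.Binary.Reasoning.Setoid setoid

  sumTo-cong-≤ : ∀ k {f g : ℕ → Carrier} → (∀ i → i ≤ k → f i ≈ g i) → sumTo k f ≈ sumTo k g
  sumTo-cong-≤ zero {f} {g} f≈g = begin
    sumTo 0 f ≈⟨ sumTo-zero f ⟩
    f 0       ≈⟨ f≈g 0 z≤n ⟩
    g 0       ≈⟨ sumTo-zero g ⟨
    sumTo 0 g ∎
  sumTo-cong-≤ (suc k) {f} {g} f≈g = begin
    sumTo (suc k) f       ≈⟨ sumTo-suc k f ⟩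
    sumTo k f + f (suc k) ≈⟨ +-cong (sumTo-cong-≤ k (λ i i≤k → f≈g i (m≤n⇒m≤1+n i≤k))) (f≈g (suc k) ≤-refl) ⟩
    sumTo k g + g (suc k) ≈⟨ sumTo-suc k g ⟨
    sumTo (suc k) g       ∎

  sumTo-cong : ∀ k {f g : ℕ → Carrier} → (∀ i → f i ≈ g i) → sumTo k f ≈ sumTo k g
  sumTo-cong k f≈g = sumTo-cong-≤ k (λ i _ → f≈g i)

  sumTo-distrib-+ : ∀ k (f g : ℕ → Carrier) → sumTo k (λ i → f i + g i) ≈ sumTo k f + sumTo k g
  sumTo-distrib-+ zero f g = trans (sumTo-zero _) (sym (+-cong (sumTo-zero f) (sumTo-zero g)))
  sumTo-distrib-+ (suc k) f g = begin
    sumTo (suc k) (λ i → f i + g i)                     ≈⟨ sumTo-suc k _ ⟩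
    sumTo k (λ i → f i + g i) + (f (suc k) + g (suc k)) ≈⟨ +-congʳ (sumTo-distrib-+ k f g) ⟩
    (sumTo k f + sumTo k g) + (f (suc k) + g (suc k))   ≈⟨ interchange _ _ _ _ ⟩
    (sumTo k f + f (suc k)) + (sumTo k g + g (suc k))   ≈⟨ +-cong (sumTo-suc k f) (sumTo-suc k g) ⟨
    sumTo (suc k) f + sumTo (suc k) g                   ∎

  sumTo-*ˡ : ∀ k a (f : ℕ → Carrier) → sumTo k (λ i → a * f i) ≈ a * sumTo k f
  sumTo-*ˡ zero a f = trans (sumTo-zero _) (*-congˡ (sym (sumTo-zero f)))
  sumTo-*ˡ (suc k) a f = begin
    sumTo (suc k) (λ i → a * f i)           ≈⟨ sumTo-suc k _ ⟩
    sumTo k (λ i → a * f i) + a * f (suc k) ≈⟨ +-congʳ (sumTo-*ˡ k a f) ⟩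
    a * sumTo k f + a * f (suc k)           ≈⟨ distribˡ a (sumTo k f) (f (suc k)) ⟨
    a * (sumTo k f + f (suc k))             ≈⟨ *-congˡ (sumTo-suc k f) ⟨
    a * sumTo (suc k) f                     ∎

  sumTo-*ʳ : ∀ k a (f : ℕ → Carrier) → sumTo k (λ i → f i * a) ≈ sumTo k f * a
  sumTo-*ʳ k a f = begin
    sumTo k (λ i → f i * a) ≈⟨ sumTo-cong k (λ i → *-comm (f i) a) ⟩
    sumTo k (λ i → a * f i) ≈⟨ sumTo-*ˡ k a f ⟩
    a * sumTo k f           ≈⟨ *-comm a (sumTo k f) ⟩
    sumTo k f * a           ∎

  sumTo-zeros : ∀ k {f : ℕ → Carrier} → (∀ i → i ≤ k → f i ≈ 0#) → sumTo k f ≈ 0#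
  sumTo-zeros zero {f} f≈0 = trans (sumTo-zero f) (f≈0 0 z≤n)
  sumTo-zeros (suc k) {f} f≈0 = begin
    sumTo (suc k) f       ≈⟨ sumTo-suc k f ⟩
    sumTo k f + f (suc k) ≈⟨ +-cong (sumTo-zeros k (λ i i≤k → f≈0 i (m≤n⇒m≤1+n i≤k))) (f≈0 (suc k) ≤-refl) ⟩
    0# + 0#               ≈⟨ +-identityˡ 0# ⟩
    0#                    ∎

  sumTo-sucˡ : ∀ k (f : ℕ → Carrier) → sumTo (suc k) f ≈ f 0 + sumTo k (λ i → f (suc i))
  sumTo-sucˡ zero f = begin
    sumTo 1 f                ≈⟨ sumTo-suc 0 f ⟩
    sumTo 0 f + f 1          ≈⟨ +-cong (sumTo-zero f) (sym (sumTo-zero _)) ⟩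
    f 0 + sumTo 0 (λ i → f (suc i)) ∎
  sumTo-sucˡ (suc k) f = begin
    sumTo (suc (suc k)) f                               ≈⟨ sumTo-suc (suc k) f ⟩
    sumTo (suc k) f + f (suc (suc k))                   ≈⟨ +-congʳ (sumTo-sucˡ k f) ⟩
    (f 0 + sumTo k (λ i → f (suc i))) + f (suc (suc k)) ≈⟨ +-assoc (f 0) _ _ ⟩
    f 0 + (sumTo k (λ i → f (suc i)) + f (suc (suc k))) ≈⟨ +-congˡ (sumTo-suc k _) ⟨
    f 0 + sumTo (suc k) (λ i → f (suc i))               ∎

  sumTo-vanishing-tail : ∀ {k l} (f : ℕ → Carrier) → k ≤ l → (∀ i → k < i → f i ≈ 0#) → sumTo l f ≈ sumTo k f
  sumTo-vanishing-tail {k} f k≤l f≈0 = go (≤⇒≤′ k≤l)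
    where
    go : ∀ {l} → k ≤′ l → sumTo l f ≈ sumTo k f
    go ≤′-refl = refl
    go (≤′-step {l} k≤′l) = begin
      sumTo (suc l) f       ≈⟨ sumTo-suc l f ⟩
      sumTo l f + f (suc l) ≈⟨ +-cong (go k≤′l) (f≈0 (suc l) (s≤s (≤′⇒≤ k≤′l))) ⟩
      sumTo k f + 0#        ≈⟨ +-identityʳ _ ⟩
      sumTo k f             ∎

  sumTo-reverse : ∀ n (f : ℕ → Carrier) → sumTo n f ≈ sumTo n (λ i → f (n ∸ i))
  sumTo-reverse zero f = sumTo-cong-≤ 0 (λ { .0 z≤n → refl })
  sumTo-reverse (suc n) f = begin
    sumTo (suc n) f                                           ≈⟨ sumTo-suc n f ⟩
    sumTo n f + f (suc n)                                     ≈⟨ +-congʳ (sumTo-reverse n f) ⟩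
    sumTo n (λ i → f (n ∸ i)) + f (suc n)                     ≈⟨ +-comm _ _ ⟩
    f (suc n) + sumTo n (λ i → f (n ∸ i))                     ≈⟨ sumTo-sucˡ n (λ i → f (suc n ∸ i)) ⟨
    sumTo (suc n) (λ i → f (suc n ∸ i))                       ∎

  sumTo-swap : ∀ a b (F : ℕ → ℕ → Carrier) →
               sumTo a (λ i → sumTo b (F i)) ≈ sumTo b (λ j → sumTo a (λ i → F i j))
  sumTo-swap zero b F = trans (sumTo-zero _) (sumTo-cong b (λ j → sym (sumTo-zero _)))
  sumTo-swap (suc a) b F = begin
    sumTo (suc a) (λ i → sumTo b (F i))                                ≈⟨ sumTo-suc a _ ⟩
    sumTo a (λ i → sumTo b (F i)) + sumTo b (F (suc a))                ≈⟨ +-congʳ (sumTo-swap a b F) ⟩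
    sumTo b (λ j → sumTo a (λ i → F i j)) + sumTo b (F (suc a))        ≈⟨ sumTo-distrib-+ b _ _ ⟨
    sumTo b (λ j → sumTo a (λ i → F i j) + F (suc a) j)                ≈⟨ sumTo-cong b (λ j → sumTo-suc a _) ⟨
    sumTo b (λ j → sumTo (suc a) (λ i → F i j))                        ∎

  sumTo-triangle : ∀ n (F : ℕ → ℕ → Carrier) →
                   sumTo n (λ m → sumTo m (λ i → F i (m ∸ i))) ≈ sumTo n (λ i → sumTo (n ∸ i) (F i))
  sumTo-triangle zero F = trans (sumTo-zero _) (trans (sumTo-zero _) (sym (trans (sumTo-zero _) (sumTo-zero _))))
  sumTo-triangle (suc n) F = begin
    sumTo (suc n) (λ m → sumTo m (λ i → F i (m ∸ i)))
      ≈⟨ sumTo-suc n _ ⟩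
    sumTo n (λ m → sumTo m (λ i → F i (m ∸ i))) + sumTo (suc n) (λ i → F i (suc n ∸ i))
      ≈⟨ +-cong (sumTo-triangle n F) (sumTo-suc n _) ⟩
    sumTo n (λ i → sumTo (n ∸ i) (F i)) + (sumTo n (λ i → F i (suc n ∸ i)) + F (suc n) (n ∸ n))
      ≈⟨ +-assoc _ _ _ ⟨
    (sumTo n (λ i → sumTo (n ∸ i) (F i)) + sumTo n (λ i → F i (suc n ∸ i))) + F (suc n) (n ∸ n)
      ≈⟨ +-cong (sumTo-distrib-+ n _ _) (reflexive (cong (F (suc n)) (Eq.sym (n∸n≡0 n)))) ⟨
    sumTo n (λ i → sumTo (n ∸ i) (F i) + F i (suc n ∸ i)) + F (suc n) 0
      ≈⟨ +-cong (sumTo-cong-≤ n (λ i i≤n → sym (peel i≤n))) (sym (sumTo-zero (F (suc n)))) ⟩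
    sumTo n (λ i → sumTo (suc n ∸ i) (F i)) + sumTo 0 (F (suc n))
      ≡⟨ cong (λ z → sumTo n (λ i → sumTo (suc n ∸ i) (F i)) + sumTo z (F (suc n))) (n∸n≡0 n) ⟨
    sumTo n (λ i → sumTo (suc n ∸ i) (F i)) + sumTo (suc n ∸ suc n) (F (suc n))
      ≈⟨ sumTo-suc n _ ⟨
    sumTo (suc n) (λ i → sumTo (suc n ∸ i) (F i))
      ∎
    where
    peel : ∀ {i} → i ≤ n → sumTo (suc n ∸ i) (F i) ≈ sumTo (n ∸ i) (F i) + F i (suc n ∸ i)
    peel {i} i≤n rewrite +-∸-assoc 1 i≤n = sumTo-suc (n ∸ i) (F i)

  infix 4 _≋_
  infixl 7 _⋆_

  _≋_ : (ℕ → Carrier) → (ℕ → Carrier) → Set ℓ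
  f ≋ g = ∀ n → f n ≈ g n

  _⋆_ : (ℕ → Carrier) → (ℕ → Carrier) → ℕ → Carrier
  (f ⋆ g) n = sumTo n (λ i → f i * g (n ∸ i))

  ⋆-cong : ∀ {f f′ g g′} → f ≋ f′ → g ≋ g′ → f ⋆ g ≋ f′ ⋆ g′
  ⋆-cong f≋f′ g≋g′ n = sumTo-cong n (λ i → *-cong (f≋f′ i) (g≋g′ (n ∸ i)))

  ⋆-congˡ : ∀ f {g g′} → g ≋ g′ → f ⋆ g ≋ f ⋆ g′
  ⋆-congˡ f = ⋆-cong {f} {f} (λ _ → refl)

  ⋆-congʳ : ∀ {f f′} g → f ≋ f′ → f ⋆ g ≋ f′ ⋆ g
  ⋆-congʳ g f≋f′ = ⋆-cong {g = g} {g′ = g} f≋f′ (λ _ → refl)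

  ⋆-comm : ∀ f g → f ⋆ g ≋ g ⋆ f
  ⋆-comm f g n = begin
    sumTo n (λ i → f i * g (n ∸ i))             ≈⟨ sumTo-reverse n _ ⟩
    sumTo n (λ i → f (n ∸ i) * g (n ∸ (n ∸ i))) ≈⟨ sumTo-cong-≤ n (λ i i≤n → reflexive (cong (λ j → f (n ∸ i) * g j) (m∸[m∸n]≡n i≤n))) ⟩
    sumTo n (λ i → f (n ∸ i) * g i)             ≈⟨ sumTo-cong n (λ i → *-comm _ _) ⟩
    sumTo n (λ i → g i * f (n ∸ i))             ∎

  ⋆-assoc : ∀ f g h → (f ⋆ g) ⋆ h ≋ f ⋆ (g ⋆ h)
  ⋆-assoc f g h n = begin
    sumTo n (λ m → sumTo m (λ i → f i * g (m ∸ i)) * h (n ∸ m))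
      ≈⟨ sumTo-cong n (λ m → sumTo-*ʳ m _ _) ⟨
    sumTo n (λ m → sumTo m (λ i → f i * g (m ∸ i) * h (n ∸ m)))
      ≈⟨ sumTo-cong-≤ n (λ m m≤n → sumTo-cong-≤ m (λ i i≤m → trans (*-assoc _ _ _)
            (reflexive (cong (λ j → f i * (g (m ∸ i) * h j)) (Eq.sym (∸-∸ i≤m)))))) ⟩
    sumTo n (λ m → sumTo m (λ i → f i * (g (m ∸ i) * h (n ∸ i ∸ (m ∸ i)))))
      ≈⟨ sumTo-triangle n (λ i j → f i * (g j * h (n ∸ i ∸ j))) ⟩
    sumTo n (λ i → sumTo (n ∸ i) (λ j → f i * (g j * h (n ∸ i ∸ j))))
      ≈⟨ sumTo-cong n (λ i → sumTo-*ˡ (n ∸ i) (f i) _) ⟩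
    sumTo n (λ i → f i * sumTo (n ∸ i) (λ j → g j * h (n ∸ i ∸ j)))
      ∎
    where
    ∸-∸ : ∀ {i m} → i ≤ m → n ∸ i ∸ (m ∸ i) ≡ n ∸ m
    ∸-∸ {i} {m} i≤m = Eq.trans (∸-+-assoc n i (m ∸ i)) (cong (n ∸_) (m+[n∸m]≡n i≤m))

  ⋆-distribʳ-+ : ∀ f g h → (λ i → f i + g i) ⋆ h ≋ (λ n → (f ⋆ h) n + (g ⋆ h) n)
  ⋆-distribʳ-+ f g h n = trans (sumTo-cong n (λ i → distribʳ (h (n ∸ i)) (f i) (g i))) (sumTo-distrib-+ n _ _)

  ⋆-*ˡ : ∀ a f g → (λ i → a * f i) ⋆ g ≋ (λ n → a * (f ⋆ g) n)
  ⋆-*ˡ a f g n = trans (sumTo-cong n (λ i → *-assoc a (f i) (g (n ∸ i)))) (sumTo-*ˡ n a _)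

  ⋆-*ʳ : ∀ a f g → f ⋆ (λ i → a * g i) ≋ (λ n → a * (f ⋆ g) n)
  ⋆-*ʳ a f g n = trans (sumTo-cong n (λ i → x∙yz≈y∙xz (f i) a (g (n ∸ i)))) (sumTo-*ˡ n a _)

  ⋆-identityˡ : ∀ {e} → e 0 ≈ 1# → (∀ i → e (suc i) ≈ 0#) → ∀ f → e ⋆ f ≋ f
  ⋆-identityˡ e0≈1 e≈0 f zero = trans (sumTo-zero _) (trans (*-congʳ e0≈1) (*-identityˡ (f 0)))
  ⋆-identityˡ {e} e0≈1 e≈0 f (suc n) = begin
    sumTo (suc n) (λ i → e i * f (suc n ∸ i))
      ≈⟨ sumTo-sucˡ n _ ⟩
    e 0 * f (suc n) + sumTo n (λ i → e (suc i) * f (n ∸ i))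
      ≈⟨ +-cong (*-congʳ e0≈1) (sumTo-zeros n (λ i _ → trans (*-congʳ (e≈0 i)) (zeroˡ _))) ⟩
    1# * f (suc n) + 0#
      ≈⟨ +-identityʳ _ ⟩
    1# * f (suc n)
      ≈⟨ *-identityˡ _ ⟩
    f (suc n)
      ∎

  ⋆-comm-assoc : ∀ f g h → f ⋆ (g ⋆ h) ≋ (g ⋆ f) ⋆ h
  ⋆-comm-assoc f g h n = trans (sym (⋆-assoc f g h n)) (⋆-congʳ h (⋆-comm f g) n)

  ⋆-swap : ∀ f g h k → (f ⋆ g) ⋆ (h ⋆ k) ≋ (f ⋆ k) ⋆ (h ⋆ g)
  ⋆-swap f g h k n = begin
    ((f ⋆ g) ⋆ (h ⋆ k)) n   ≈⟨ ⋆-assoc f g (h ⋆ k) n ⟩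
    (f ⋆ (g ⋆ (h ⋆ k))) n   ≈⟨ ⋆-congˡ f (⋆-congˡ g (⋆-comm h k)) n ⟩
    (f ⋆ (g ⋆ (k ⋆ h))) n   ≈⟨ ⋆-congˡ f (⋆-assoc g k h) n ⟨
    (f ⋆ ((g ⋆ k) ⋆ h)) n   ≈⟨ ⋆-congˡ f (⋆-congʳ h (⋆-comm g k)) n ⟩
    (f ⋆ ((k ⋆ g) ⋆ h)) n   ≈⟨ ⋆-congˡ f (⋆-assoc k g h) n ⟩
    (f ⋆ (k ⋆ (g ⋆ h))) n   ≈⟨ ⋆-assoc f k (g ⋆ h) n ⟨
    ((f ⋆ k) ⋆ (g ⋆ h)) n   ≈⟨ ⋆-congˡ (f ⋆ k) (⋆-comm g h) n ⟩
    ((f ⋆ k) ⋆ (h ⋆ g)) n   ∎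

module ℕSum = FiniteSums ℕ.+-*-commutativeSemiring sumToℕ (λ _ → ≡.refl) (λ _ _ → ≡.refl)

module Counting {A : Set} where

  open import Level using (0ℓ)
  open import Data.Nat using (ℕ; suc; _+_; _*_)
  open import Data.Nat.Properties using (+-suc)
  open import Data.Unit using (⊤; tt)
  open import Relation.Binary.Definitions using (DecidableEquality)
  open import Data.Product using (_×_; _,_)
  open import Data.Sum using (inj₁; inj₂; [_,_]′)
  open import Data.Nat.ListAction using (sum)
  open import Data.List using (List; []; _∷_; map; filter; length)
  open import Data.List.Properties using (length-map; filter-all; filter-none)
  open import Data.List.Membership.Propositional using (_∈_)
  open import Data.List.Membership.Propositional.Properties using (∈-map⁺; ∈-filter⁺; ∈-filter⁻)
  open import Data.List.Membership.Propositional.Properties.WithK using (unique∧set⇒bag)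
  open import Data.List.Relation.Binary.BagAndSetEquality using (∼bag⇒↭)
  open import Data.List.Relation.Binary.Permutation.Propositional.Properties using (filter-↭; ↭-length)
  open import Data.List.Relation.Unary.All as All using (All)
  open import Data.List.Relation.Unary.Any using (here; there)
  open import Data.List.Relation.Unary.AllPairs using ([]; _∷_)
  open import Data.List.Relation.Unary.Unique.Propositional using (Unique)
  import Data.List.Relation.Unary.Unique.Propositional.Properties as Unique
  open import Function using (_∘_; mk⇔)
  open import Relation.Nullary using (¬_; ¬?; yes; no)
  open import Relation.Nullary.Decidable using (toSum; _×-dec_)
  open import Relation.Nullary.Negation using (contradiction)
  open import Relation.Unary using (Pred; Decidable; _≐_; _∪_)
  open import Relation.Binary.PropositionalEquality using (_≡_; _≢_; refl; sym; trans; cong; cong₂; subst; module ≡-Reasoning)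

  length-filter-∪ : ∀ {P Q R : Pred A 0ℓ} (P? : Decidable P) (Q? : Decidable Q) (R? : Decidable R) →
                    P ≐ Q ∪ R → (∀ {x} → Q x → ¬ R x) →
                    ∀ xs → length (filter P? xs) ≡ length (filter Q? xs) + length (filter R? xs)
  length-filter-∪ P? Q? R? _ _ [] = refl
  length-filter-∪ P? Q? R? P≐Q∪R@(P⊆Q∪R , Q∪R⊆P) disjoint (x ∷ xs)
    with ih ← length-filter-∪ P? Q? R? P≐Q∪R disjoint xs | P? x | Q? x | R? x
  ... | _     | yes q | yes r = contradiction r (disjoint q)
  ... | yes _ | yes _ | no _  = cong suc ih
  ... | yes _ | no _  | yes _ = trans (cong suc ih) (sym (+-suc _ _))
  ... | yes p | no ¬q | no ¬r = [ (λ q → contradiction q ¬q) , (λ r → contradiction r ¬r) ]′ (P⊆Q∪R p)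
  ... | no ¬p | yes q | _     = contradiction (Q∪R⊆P (inj₁ q)) ¬p
  ... | no ¬p | no _  | yes r = contradiction (Q∪R⊆P (inj₂ r)) ¬p
  ... | no _  | no _  | no _  = ih

  filter-map : ∀ {P : Pred A 0ℓ} (P? : Decidable P) (φ : A → A) xs →
               filter P? (map φ xs) ≡ map φ (filter (P? ∘ φ) xs)
  filter-map P? φ [] = refl
  filter-map P? φ (x ∷ xs) with P? (φ x)
  ... | yes _ = cong (φ x ∷_) (filter-map P? φ xs)
  ... | no _  = filter-map P? φ xs

  -- A bijection of A permutes a duplicate-free list containing every element of A.
  length-filter-∘-inverse : ∀ {P : Pred A 0ℓ} (P? : Decidable P) (φ ψ : A → A) →
    (∀ x → ψ (φ x) ≡ x) → (∀ x → φ (ψ x) ≡ x) → ∀ {xs} → Unique xs → (∀ x → x ∈ xs) →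
    length (filter (P? ∘ φ) xs) ≡ length (filter P? xs)
  length-filter-∘-inverse P? φ ψ ψφ φψ {xs} unique complete = begin
    length (filter (P? ∘ φ) xs)         ≡⟨ length-map φ (filter (P? ∘ φ) xs) ⟨
    length (map φ (filter (P? ∘ φ) xs)) ≡⟨ cong length (filter-map P? φ xs) ⟨
    length (filter P? (map φ xs))       ≡⟨ ↭-length (filter-↭ P? map-φ↭id) ⟩
    length (filter P? xs)               ∎
    where
    open ≡-Reasoning
    φ-injective : ∀ {x y} → φ x ≡ φ y → x ≡ y
    φ-injective {x} {y} φx≡φy = trans (sym (ψφ x)) (trans (cong ψ φx≡φy) (ψφ y))
    map-φ↭id = ∼bag⇒↭ (unique∧set⇒bag (Unique.map⁺ φ-injective unique) unique
                 (λ {x} → mk⇔ (λ _ → complete x) (λ _ → subst (_∈ map φ xs) (φψ x) (∈-map⁺ φ (complete (ψ x))))))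

  length-filter-≡1 : ∀ {P : Pred A 0ℓ} (P? : Decidable P) {a xs} → Unique xs → a ∈ xs → P a →
                     (∀ {x} → P x → x ≡ a) → length (filter P? xs) ≡ 1
  length-filter-≡1 P? {xs = x ∷ xs} (x∉xs ∷ _) (here refl) Px P⇒≡x with P? x
  ... | yes _ = cong (suc ∘ length) (filter-none P? (All.map (λ x≢y Py → x≢y (sym (P⇒≡x Py))) x∉xs))
  ... | no ¬Px = contradiction Px ¬Px
  length-filter-≡1 P? {xs = x ∷ xs} (x∉xs ∷ unique) (there a∈xs) Pa P⇒≡a with P? x
  ... | yes Px = contradiction (P⇒≡a Px) (All.lookup x∉xs a∈xs)
  ... | no _ = length-filter-≡1 P? unique a∈xs Pa P⇒≡a

  sum-map-≡-const : ∀ {f : A → ℕ} {c xs} → All (λ x → f x ≡ c) xs → sum (map f xs) ≡ length xs * c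
  sum-map-≡-const All.[] = refl
  sum-map-≡-const (fx≡c All.∷ fxs≡c) = cong₂ _+_ fx≡c (sum-map-≡-const fxs≡c)

  module Removal (_≟_ : DecidableEquality A) where

    _∖_ : List A → A → List A
    xs ∖ y = filter (λ x → ¬? (x ≟ y)) xs

    length-∖ : ∀ {y xs} → Unique xs → y ∈ xs → length xs ≡ suc (length (xs ∖ y))
    length-∖ {y} {xs} unique y∈xs = begin
      length xs
        ≡⟨ cong length (filter-all (λ _ → yes tt) (All.universal _ xs)) ⟨
      length (filter (λ _ → yes tt) xs)
        ≡⟨ length-filter-∪ (λ _ → yes tt) (_≟ y) (λ x → ¬? (x ≟ y)) split (λ x≡y x≢y → x≢y x≡y) xs ⟩
      length (filter (_≟ y) xs) + length (xs ∖ y)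
        ≡⟨ cong (_+ length (xs ∖ y)) (length-filter-≡1 (_≟ y) unique y∈xs refl (λ x≡y → x≡y)) ⟩
      suc (length (xs ∖ y))
        ∎
      where
      open ≡-Reasoning
      split : (λ _ → ⊤) ≐ (_≡ y) ∪ (_≢ y)
      split = (λ {x} _ → toSum (x ≟ y)) , (λ _ → tt)

    ∈-∖⁺ : ∀ {x y xs} → x ∈ xs → x ≢ y → x ∈ xs ∖ y
    ∈-∖⁺ = ∈-filter⁺ (λ x → ¬? (x ≟ _))

    ∈-∖⁻ : ∀ {x y} xs → x ∈ xs ∖ y → x ∈ xs × x ≢ y
    ∈-∖⁻ xs = ∈-filter⁻ (λ x → ¬? (x ≟ _)) {xs = xs}

    ∖-unique : ∀ {y xs} → Unique xs → Unique (xs ∖ y)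
    ∖-unique = Unique.filter⁺ (λ x → ¬? (x ≟ _))

  module _ {B : Set} (_≟_ : DecidableEquality B) where

    open import Data.List.Membership.DecPropositional _≟_ using (_∈?_)

    length-filter-∈ : ∀ {P : Pred A 0ℓ} (P? : Decidable P) (f : A → B) {ys} → Unique ys → ∀ xs →
      length (filter (λ x → P? x ×-dec f x ∈? ys) xs)
        ≡ sum (map (λ y → length (filter (λ x → P? x ×-dec f x ≟ y) xs)) ys)
    length-filter-∈ P? f {[]} _ xs = cong length (filter-none _ (All.universal (λ _ → λ ()) xs))
    length-filter-∈ {P} P? f {y ∷ ys} (y∉ys ∷ unique) xs =
      trans (length-filter-∪ _ _ _ split disjoint xs) (cong (_ +_) (length-filter-∈ P? f unique xs))
      where
      split : (λ x → P x × f x ∈ y ∷ ys) ≐ (λ x → P x × f x ≡ y) ∪ (λ x → P x × f x ∈ ys)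
      split = (λ { (p , here fx≡y) → inj₁ (p , fx≡y) ; (p , there fx∈ys) → inj₂ (p , fx∈ys) })
            , (λ { (inj₁ (p , fx≡y)) → p , here fx≡y ; (inj₂ (p , fx∈ys)) → p , there fx∈ys })
      disjoint : ∀ {x} → P x × f x ≡ y → ¬ (P x × f x ∈ ys)
      disjoint (_ , refl) (_ , fx∈ys) = All.lookup y∉ys fx∈ys refl

module Involutions where

  open import Data.Nat using (ℕ; zero; suc; _+_; _*_; _≤_; pred; s≤s)
  open import Data.Nat.Properties using (≤-refl; ≤-trans)
  open import Data.Product using (_×_; _,_; proj₁; proj₂)
  open import Data.Sum using (_⊎_; inj₁; inj₂; [_,_]′)
  open import Data.Nat.ListAction using (sum)
  open import Data.Fin using (Fin; _≟_)
  open import Data.Fin.Properties using (all?)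
  open import Data.Fin.Permutation.Components using (transpose; transpose-inverse)
  open import Data.Vec using (Vec; lookup; tabulate)
  open import Data.Vec.Properties using (lookup∘tabulate; tabulate∘lookup; tabulate-cong; ∷-injective)
  import Data.Vec.Properties as Vec
  open import Data.List using (List; []; _∷_; _++_; map; filter; length; concatMap; cartesianProductWith; allFin)
  open import Data.List.Properties using (length-filter; filter-≐; map-cong-local; length-tabulate)
  open import Data.List.Membership.Propositional using (_∈_; _∉_)
  open import Data.List.Membership.Propositional.Properties using (∈-cartesianProductWith⁺; ∈-allFin)
  open import Data.List.Relation.Unary.All as All using ()
  open import Data.List.Relation.Unary.Any as Any using (here; there)
  open import Data.List.Relation.Unary.AllPairs using ([]; _∷_)
  open import Data.List.Relation.Unary.Unique.Propositional using (Unique)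
  import Data.List.Relation.Unary.Unique.Propositional.Properties as Unique
  open import Function using (_∘_; id)
  open import Relation.Nullary using (¬_; ¬?; yes; no)
  open import Relation.Nullary.Decidable using (_×-dec_; dec-true; dec-false; _→-dec_)
  open import Relation.Nullary.Negation using (contradiction)
  open import Relation.Unary using (Decidable; _≐_; _∪_)
  open import Relation.Binary.PropositionalEquality using (_≡_; _≢_; refl; sym; trans; cong; cong₂; subst; module ≡-Reasoning)

  open Counting

  concatMap≡cartesianProductWith : ∀ {A : Set} {n} (vs : List (Vec A n)) xs →
    concatMap (λ x → map (x Vec.∷_) vs) xs ≡ cartesianProductWith Vec._∷_ xs vs
  concatMap≡cartesianProductWith vs [] = refl
  concatMap≡cartesianProductWith vs (x ∷ xs) = cong (map (x Vec.∷_) vs ++_) (concatMap≡cartesianProductWith vs xs)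

  allVecs-unique : ∀ {A : Set} n {xs : List A} → Unique xs → Unique (allVecs n xs)
  allVecs-unique zero _ = All.[] ∷ []
  allVecs-unique (suc n) {xs} unique = subst Unique (sym (concatMap≡cartesianProductWith (allVecs n xs) xs))
    (Unique.cartesianProductWith⁺ Vec._∷_ ∷-injective unique (allVecs-unique n unique))

  allVecs-complete : ∀ {A : Set} n {xs : List A} → (∀ x → x ∈ xs) → ∀ v → v ∈ allVecs n xs
  allVecs-complete zero complete Vec.[] = here refl
  allVecs-complete (suc n) {xs} complete (x Vec.∷ v) = subst ((x Vec.∷ v) ∈_) (sym (concatMap≡cartesianProductWith (allVecs n xs) xs))
    (∈-cartesianProductWith⁺ Vec._∷_ (complete x) (allVecs-complete n complete v))

  involutionNumber : ℕ → ℕ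
  involutionNumber 0 = 1
  involutionNumber 1 = 1
  involutionNumber (suc (suc n)) = involutionNumber (suc n) + suc n * involutionNumber n

  involutionNumber-suc : ∀ n → involutionNumber (suc n) ≡ involutionNumber n + n * involutionNumber (pred n)
  involutionNumber-suc zero = refl
  involutionNumber-suc (suc n) = refl

  transpose-matchˡ : ∀ {n} (x y : Fin n) → transpose x y x ≡ y
  transpose-matchˡ x y rewrite dec-true (x ≟ x) refl = refl

  transpose-matchʳ : ∀ {n} (x y : Fin n) → transpose x y y ≡ x
  transpose-matchʳ x y with y ≟ x
  ... | yes refl = refl
  ... | no _ rewrite dec-true (y ≟ y) refl = refl

  transpose-other : ∀ {n} {x y k : Fin n} → k ≢ x → k ≢ y → transpose x y k ≡ k
  transpose-other {x = x} {y} {k} k≢x k≢y rewrite dec-false (k ≟ x) k≢x | dec-false (k ≟ y) k≢y = refl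

  module _ (m : ℕ) where

    open import Data.List.Membership.DecPropositional (_≟_ {m}) using (_∈?_)

    Map : Set
    Map = Vec (Fin m) m

    maps : List Map
    maps = allVecs m (allFin m)

    maps-unique : Unique maps
    maps-unique = allVecs-unique m (Unique.allFin⁺ m)

    maps-complete : ∀ v → v ∈ maps
    maps-complete = allVecs-complete m ∈-allFin

    InvolutiveOn : List (Fin m) → Map → Set
    InvolutiveOn S v = ∀ i → (i ∈ S → lookup v (lookup v i) ≡ i) × (i ∉ S → lookup v i ≡ i)

    involutiveOn? : ∀ S → Decidable (InvolutiveOn S)
    involutiveOn? S v = all? (λ i → (i ∈? S →-dec lookup v (lookup v i) ≟ i) ×-dec (¬? (i ∈? S) →-dec lookup v i ≟ i))

    involutions : List (Fin m) → ℕ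
    involutions S = length (filter (involutiveOn? S) maps)

    open Removal (_≟_ {m})

    involutiveOn-closed : ∀ {S v i} → InvolutiveOn S v → i ∈ S → lookup v i ∈ S
    involutiveOn-closed {S} {v} {i} inv i∈S with lookup v i ∈? S
    ... | yes vi∈S = vi∈S
    ... | no vi∉S = contradiction (subst (_∈ S) (trans (sym (proj₁ (inv i) i∈S)) (proj₂ (inv (lookup v i)) vi∉S)) i∈S) vi∉S

    involutions-allFin : t m ≡ involutions (allFin m)
    involutions-allFin = cong length (filter-≐ isInvolution? (involutiveOn? (allFin m)) ((λ {v} → to v) , (λ {v} → from v)) maps)
      where
      to : ∀ v → IsInvolution v → InvolutiveOn (allFin m) v
      to v inv i = (λ _ → inv i) , (λ i∉allFin → contradiction (∈-allFin i) i∉allFin)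
      from : ∀ v → InvolutiveOn (allFin m) v → IsInvolution v
      from v inv i = proj₁ (inv i) (∈-allFin i)

    involutions-[] : involutions [] ≡ 1
    involutions-[] = length-filter-≡1 (involutiveOn? []) maps-unique (maps-complete identity) identity-involutiveOn (λ {v} → []-identity v)
      where
      identity : Map
      identity = tabulate (λ i → i)
      identity-involutiveOn : InvolutiveOn [] identity
      identity-involutiveOn i = (λ ()) , (λ _ → lookup∘tabulate (λ i → i) i)
      []-identity : ∀ v → InvolutiveOn [] v → v ≡ identity
      []-identity v inv = trans (sym (tabulate∘lookup v)) (tabulate-cong (λ i → proj₂ (inv i) (λ ())))

    precompose : (Fin m → Fin m) → Map → Map
    precompose σ v = tabulate (lookup v ∘ σ)

    lookup-precompose : ∀ σ v i → lookup (precompose σ v) i ≡ lookup v (σ i)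
    lookup-precompose σ v = lookup∘tabulate (lookup v ∘ σ)

    precompose-inverse : ∀ σ ρ → (∀ i → σ (ρ i) ≡ i) → ∀ v → precompose ρ (precompose σ v) ≡ v
    precompose-inverse σ ρ σρ v =
      trans (tabulate-cong (λ i → trans (lookup-precompose σ v (ρ i)) (cong (lookup v) (σρ i)))) (tabulate∘lookup v)

    module _ {x : Fin m} {S : List (Fin m)} (x∉S : x ∉ S) where

      Sends-x-to : Fin m → Map → Set
      Sends-x-to z v = InvolutiveOn (x ∷ S) v × lookup v x ≡ z

      sends-x-to? : ∀ z → Decidable (Sends-x-to z)
      sends-x-to? z v = involutiveOn? (x ∷ S) v ×-dec lookup v x ≟ z

      fixing : Sends-x-to x ≐ InvolutiveOn S
      fixing = (λ {v} → to v) , (λ {v} → from v)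
        where
        to : ∀ v → Sends-x-to x v → InvolutiveOn S v
        to v (inv , vx≡x) i = (λ i∈S → proj₁ (inv i) (there i∈S)) , outside
          where
          outside : i ∉ S → lookup v i ≡ i
          outside i∉S with i ≟ x
          ... | yes refl = vx≡x
          ... | no i≢x = proj₂ (inv i) (λ { (here i≡x) → i≢x i≡x ; (there i∈S) → i∉S i∈S })
        from : ∀ v → InvolutiveOn S v → Sends-x-to x v
        from v inv = (λ i → inside i , (λ i∉x∷S → proj₂ (inv i) (i∉x∷S ∘ there))) , vx≡x
          where
          vx≡x = proj₂ (inv x) x∉S
          inside : ∀ i → i ∈ x ∷ S → lookup v (lookup v i) ≡ i
          inside i (here refl) = trans (cong (lookup v) vx≡x) vx≡x
          inside i (there i∈S) = proj₁ (inv i) i∈S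

      module _ {y : Fin m} (y∈S : y ∈ S) where

        private
          φ : Map → Map
          φ = precompose (transpose x y)

          x∉S∖y : x ∉ S ∖ y
          x∉S∖y x∈S∖y = x∉S (proj₁ (∈-∖⁻ S x∈S∖y))

          y∉S∖y : y ∉ S ∖ y
          y∉S∖y y∈S∖y = proj₂ (∈-∖⁻ S y∈S∖y) refl

          ∈S⇒≢x : ∀ {k} → k ∈ S → k ≢ x
          ∈S⇒≢x k∈S refl = x∉S k∈S

        swapping-sound : ∀ v → Sends-x-to y v → InvolutiveOn (S ∖ y) (φ v)
        swapping-sound v (inv , vx≡y) k = inside , outside
          where
          vy≡x : lookup v y ≡ x
          vy≡x = trans (cong (lookup v) (sym vx≡y)) (proj₁ (inv x) (here refl))
          φv-other : ∀ {j} → j ≢ x → j ≢ y → lookup (φ v) j ≡ lookup v j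
          φv-other j≢x j≢y = trans (lookup-precompose _ v _) (cong (lookup v) (transpose-other j≢x j≢y))
          inside : k ∈ S ∖ y → lookup (φ v) (lookup (φ v) k) ≡ k
          inside k∈S∖y = trans (cong (lookup (φ v)) (φv-other k≢x k≢y)) (trans (φv-other vk≢x vk≢y) vvk≡k)
            where
            k∈S = proj₁ (∈-∖⁻ S k∈S∖y)
            k≢y = proj₂ (∈-∖⁻ S k∈S∖y)
            k≢x = ∈S⇒≢x k∈S
            vvk≡k = proj₁ (inv k) (there k∈S)
            vk≢x : lookup v k ≢ x
            vk≢x vk≡x = k≢y (trans (sym vvk≡k) (trans (cong (lookup v) vk≡x) vx≡y))
            vk≢y : lookup v k ≢ y
            vk≢y vk≡y = k≢x (trans (sym vvk≡k) (trans (cong (lookup v) vk≡y) vy≡x))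
          outside : k ∉ S ∖ y → lookup (φ v) k ≡ k
          outside k∉S∖y with k ≟ x | k ≟ y
          ... | yes refl | _        = trans (lookup-precompose _ v x) (trans (cong (lookup v) (transpose-matchˡ x y)) vy≡x)
          ... | no _     | yes refl = trans (lookup-precompose _ v y) (trans (cong (lookup v) (transpose-matchʳ x y)) vx≡y)
          ... | no k≢x   | no k≢y   = trans (φv-other k≢x k≢y) (proj₂ (inv k) k∉x∷S)
            where
            k∉x∷S : k ∉ x ∷ S
            k∉x∷S (here k≡x)  = k≢x k≡x
            k∉x∷S (there k∈S) = k∉S∖y (∈-∖⁺ k∈S k≢y)

        swapping-complete : ∀ v → InvolutiveOn (S ∖ y) (φ v) → Sends-x-to y v
        swapping-complete v inv = (λ k → inside k , outside k) , vx≡y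
          where
          u = φ v
          v-via-u : ∀ k → lookup v k ≡ lookup u (transpose y x k)
          v-via-u k = trans (cong (λ w → lookup w k) (sym (precompose-inverse (transpose x y) (transpose y x) (λ _ → transpose-inverse x y) v)))
                            (lookup-precompose _ u k)
          v-other : ∀ {j} → j ≢ x → j ≢ y → lookup v j ≡ lookup u j
          v-other j≢x j≢y = trans (v-via-u _) (cong (lookup u) (transpose-other j≢y j≢x))
          vx≡y : lookup v x ≡ y
          vx≡y = trans (v-via-u x) (trans (cong (lookup u) (transpose-matchʳ y x)) (proj₂ (inv y) y∉S∖y))
          vy≡x : lookup v y ≡ x
          vy≡x = trans (v-via-u y) (trans (cong (lookup u) (transpose-matchˡ y x)) (proj₂ (inv x) x∉S∖y))
          inside : ∀ k → k ∈ x ∷ S → lookup v (lookup v k) ≡ k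
          inside k (here refl) = trans (cong (lookup v) vx≡y) vy≡x
          inside k (there k∈S) with k ≟ y
          ... | yes refl = trans (cong (lookup v) vy≡x) vx≡y
          ... | no k≢y   = trans (cong (lookup v) (v-other k≢x k≢y)) (trans (v-other uk≢x uk≢y) (proj₁ (inv k) k∈S∖y))
            where
            k≢x = ∈S⇒≢x k∈S
            k∈S∖y = ∈-∖⁺ k∈S k≢y
            uk∈S∖y = involutiveOn-closed {v = u} inv k∈S∖y
            uk≢x = ∈S⇒≢x (proj₁ (∈-∖⁻ S uk∈S∖y))
            uk≢y = proj₂ (∈-∖⁻ S uk∈S∖y)
          outside : ∀ k → k ∉ x ∷ S → lookup v k ≡ k
          outside k k∉x∷S = trans (v-other (k∉x∷S ∘ here) k≢y) (proj₂ (inv k) (k∉x∷S ∘ there ∘ proj₁ ∘ ∈-∖⁻ S))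
            where
            k≢y : k ≢ y
            k≢y refl = k∉x∷S (there y∈S)

        -- Precomposing with the transposition of x and y turns the 2-cycle (x y) into two fixed points.
        swapping : Sends-x-to y ≐ InvolutiveOn (S ∖ y) ∘ precompose (transpose x y)
        swapping = (λ {v} → swapping-sound v) , (λ {v} → swapping-complete v)

        sends-x-to-count : length (filter (sends-x-to? y) maps) ≡ involutions (S ∖ y)
        sends-x-to-count = trans (cong length (filter-≐ (sends-x-to? y) (involutiveOn? (S ∖ y) ∘ φ) swapping maps))
          (length-filter-∘-inverse (involutiveOn? (S ∖ y)) φ (precompose (transpose y x))
            (precompose-inverse (transpose x y) (transpose y x) (λ _ → transpose-inverse x y))
            (precompose-inverse (transpose y x) (transpose x y) (λ _ → transpose-inverse y x))
            maps-unique maps-complete)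

      involutions-∷ : Unique S → involutions (x ∷ S) ≡ involutions S + sum (map (λ y → involutions (S ∖ y)) S)
      involutions-∷ unique = begin
        involutions (x ∷ S)
          ≡⟨ length-filter-∪ (involutiveOn? (x ∷ S)) (sends-x-to? x) sends-x-into-S? split (λ {v} → disjoint {v}) maps ⟩
        length (filter (sends-x-to? x) maps) + length (filter sends-x-into-S? maps)
          ≡⟨ cong₂ _+_ (cong length (filter-≐ (sends-x-to? x) (involutiveOn? S) fixing maps))
                       (length-filter-∈ _≟_ (involutiveOn? (x ∷ S)) (λ v → lookup v x) unique maps) ⟩
        involutions S + sum (map (λ y → length (filter (sends-x-to? y) maps)) S)
          ≡⟨ cong (λ ns → involutions S + sum ns) (map-cong-local (All.tabulate sends-x-to-count)) ⟩
        involutions S + sum (map (λ y → involutions (S ∖ y)) S)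
          ∎
        where
        open ≡-Reasoning
        Sends-x-into-S : Map → Set
        Sends-x-into-S v = InvolutiveOn (x ∷ S) v × lookup v x ∈ S
        sends-x-into-S? : Decidable Sends-x-into-S
        sends-x-into-S? v = involutiveOn? (x ∷ S) v ×-dec lookup v x ∈? S
        split : InvolutiveOn (x ∷ S) ≐ Sends-x-to x ∪ Sends-x-into-S
        split = (λ {v} → to v) , [ proj₁ , proj₁ ]′
          where
          to : ∀ v → InvolutiveOn (x ∷ S) v → Sends-x-to x v ⊎ Sends-x-into-S v
          to v inv = [ (λ vx≡x → inj₁ (inv , vx≡x)) , (λ vx∈S → inj₂ (inv , vx∈S)) ]′
                     (Any.toSum (involutiveOn-closed {v = v} inv (here refl)))
        disjoint : ∀ {v} → Sends-x-to x v → ¬ Sends-x-into-S v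
        disjoint (_ , vx≡x) (_ , vx∈S) = x∉S (subst (_∈ S) vx≡x vx∈S)

    involutions≡involutionNumber : ∀ {S} → Unique S → involutions S ≡ involutionNumber (length S)
    involutions≡involutionNumber {S} unique = go (length S) S unique ≤-refl
      where
      open ≡-Reasoning
      go : ∀ k S → Unique S → length S ≤ k → involutions S ≡ involutionNumber (length S)
      go _ [] _ _ = involutions-[]
      go (suc k) (x ∷ S) (x≢S ∷ unique) (s≤s |S|≤k) = begin
        involutions (x ∷ S)
          ≡⟨ involutions-∷ (λ x∈S → All.lookup x≢S x∈S refl) unique ⟩
        involutions S + sum (map (λ y → involutions (S ∖ y)) S)
          ≡⟨ cong₂ _+_ (go k S unique |S|≤k) (sum-map-≡-const (All.tabulate involutions-∖)) ⟩
        involutionNumber (length S) + length S * involutionNumber (pred (length S))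
          ≡⟨ involutionNumber-suc (length S) ⟨
        involutionNumber (suc (length S))
          ∎
        where
        involutions-∖ : ∀ {y} → y ∈ S → involutions (S ∖ y) ≡ involutionNumber (pred (length S))
        involutions-∖ y∈S = trans (go k (S ∖ _) (∖-unique unique) (≤-trans (length-filter _ S) |S|≤k))
                            (cong (involutionNumber ∘ pred) (sym (length-∖ unique y∈S)))

  t≡involutionNumber : ∀ m → t m ≡ involutionNumber m
  t≡involutionNumber m = begin
    t m                                          ≡⟨ involutions-allFin m ⟩
    involutions m (allFin m)                     ≡⟨ involutions≡involutionNumber m (Unique.allFin⁺ m) ⟩
    involutionNumber (length (allFin m))         ≡⟨ cong involutionNumber (length-tabulate {n = m} id) ⟩
    involutionNumber m                           ∎
    where open ≡-Reasoning

  t-suc : ∀ n → t (suc n) ≡ t n + n * t (pred n)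
  t-suc n rewrite t≡involutionNumber (suc n) | t≡involutionNumber n | t≡involutionNumber (pred n) = involutionNumber-suc n

module ListSums where

  open import Data.Nat using (ℕ; zero; suc; _+_; _*_)
  open import Data.Nat.Properties using (*-zeroʳ; *-distribˡ-+; +-commutativeSemigroup)
  open import Data.Nat.ListAction using (sum)
  open import Algebra.Properties.CommutativeSemigroup +-commutativeSemigroup using (interchange)
  open import Data.List using (List; []; _∷_; map; filter)
  open import Data.List.Properties using (filter-accept; filter-reject)
  open import Data.List.Membership.Propositional using (_∈_)
  open import Data.List.Relation.Unary.Any using (here; there)
  open import Function using (_∘_)
  open import Relation.Nullary using (¬_)
  open import Relation.Unary using (Decidable)
  open import Relation.Binary.PropositionalEquality using (_≡_; refl; sym; trans; cong; cong₂; module ≡-Reasoning)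

  ∑ : {A : Set} → List A → (A → ℕ) → ℕ
  ∑ xs f = sum (map f xs)

  infix 5 ∑
  syntax ∑ xs (λ x → e) = ∑[ x ∈ xs ] e

  module _ {A : Set} where

    ∑-map : ∀ {B : Set} (g : B → A) xs (f : A → ℕ) → ∑ (map g xs) f ≡ ∑ xs (f ∘ g)
    ∑-map g [] f = refl
    ∑-map g (x ∷ xs) f = cong (f (g x) +_) (∑-map g xs f)

    ∑-cong : ∀ xs {f g : A → ℕ} → (∀ {x} → x ∈ xs → f x ≡ g x) → ∑ xs f ≡ ∑ xs g
    ∑-cong [] f≡g = refl
    ∑-cong (x ∷ xs) f≡g = cong₂ _+_ (f≡g (here refl)) (∑-cong xs (f≡g ∘ there))

    ∑-distrib-+ : ∀ xs (f g : A → ℕ) → ∑[ x ∈ xs ] (f x + g x) ≡ ∑ xs f + ∑ xs g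
    ∑-distrib-+ [] f g = refl
    ∑-distrib-+ (x ∷ xs) f g =
      trans (cong ((f x + g x) +_) (∑-distrib-+ xs f g)) (interchange (f x) (g x) (∑ xs f) (∑ xs g))

    ∑-*ˡ : ∀ xs c (f : A → ℕ) → ∑[ x ∈ xs ] (c * f x) ≡ c * ∑ xs f
    ∑-*ˡ [] c f = sym (*-zeroʳ c)
    ∑-*ˡ (x ∷ xs) c f = trans (cong (c * f x +_) (∑-*ˡ xs c f)) (sym (*-distribˡ-+ c (f x) (∑ xs f)))

    ∑-sumTo : ∀ xs k (c : ℕ → ℕ) (h : A → ℕ → ℕ) →
              ∑[ x ∈ xs ] sumToℕ k (λ i → c i * h x i) ≡ sumToℕ k (λ i → c i * (∑[ x ∈ xs ] h x i))
    ∑-sumTo xs zero c h = ∑-*ˡ xs (c 0) (λ x → h x 0)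
    ∑-sumTo xs (suc k) c h = trans (∑-distrib-+ xs _ _) (cong₂ _+_ (∑-sumTo xs k c h) (∑-*ˡ xs (c (suc k)) (λ x → h x (suc k))))

    ∑-zeros : ∀ xs {f : A → ℕ} → (∀ {x} → x ∈ xs → f x ≡ 0) → ∑ xs f ≡ 0
    ∑-zeros [] f≡0 = refl
    ∑-zeros (x ∷ xs) f≡0 = cong₂ _+_ (f≡0 (here refl)) (∑-zeros xs (f≡0 ∘ there))

    module _ {P : A → Set} (P? : Decidable P) (G : A → ℕ) where

      ∑-filter-accept : ∀ x xs → P x → ∑ (filter P? (x ∷ xs)) G ≡ G x + ∑ (filter P? xs) G
      ∑-filter-accept x xs Px = cong (λ ys → ∑ ys G) (filter-accept P? {xs = xs} Px)

      ∑-filter-reject : ∀ x xs → ¬ P x → ∑ (filter P? (x ∷ xs)) G ≡ ∑ (filter P? xs) G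
      ∑-filter-reject x xs ¬Px = cong (λ ys → ∑ ys G) (filter-reject P? {xs = xs} ¬Px)

module Binomials where

  open import Data.Nat using (zero; suc; _+_; _*_; _∸_)
  open import Data.Nat.Properties using (+-comm; +-identityʳ; *-identityʳ; *-zeroʳ; *-distribˡ-+; *-distribʳ-∸; m+n∸n≡m)
  open import Data.Nat.Combinatorics using (_C_; nC1≡n; nCk+nC[k+1]≡[n+1]C[k+1])
  open import Data.Nat.Solver using (module +-*-Solver)
  open +-*-Solver using (solve; _:+_; _:*_; _:=_; con)
  open import Relation.Binary.PropositionalEquality using (_≡_; refl; sym; trans; cong; cong₂; module ≡-Reasoning)

  [1+k]*[1+n]C[1+k]≡[1+n]*nCk : ∀ n k → suc k * (suc n C suc k) ≡ suc n * (n C k)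
  [1+k]*[1+n]C[1+k]≡[1+n]*nCk zero    zero    = refl
  [1+k]*[1+n]C[1+k]≡[1+n]*nCk zero    (suc k) = *-zeroʳ (suc (suc k))
  [1+k]*[1+n]C[1+k]≡[1+n]*nCk (suc m) zero    = trans (+-identityʳ _) (trans (nC1≡n (suc (suc m))) (sym (*-identityʳ (suc (suc m)))))
  [1+k]*[1+n]C[1+k]≡[1+n]*nCk (suc m) (suc k) = begin
    suc (suc k) * (suc (suc m) C suc (suc k))
      ≡⟨ cong (suc (suc k) *_) (nCk+nC[k+1]≡[n+1]C[k+1] (suc m) (suc k)) ⟨
    suc (suc k) * (x + y)
      ≡⟨ solve 3 (λ k x y → (con 1 :+ k) :* (x :+ y) := k :* x :+ x :+ (con 1 :+ k) :* y) refl (suc k) x y ⟩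
    suc k * x + x + suc (suc k) * y
      ≡⟨ cong₂ (λ u v → u + x + v) ([1+k]*[1+n]C[1+k]≡[1+n]*nCk m k) ([1+k]*[1+n]C[1+k]≡[1+n]*nCk m (suc k)) ⟩
    suc m * (m C k) + x + suc m * (m C suc k)
      ≡⟨ solve 4 (λ n a x b → n :* a :+ x :+ n :* b := n :* (a :+ b) :+ x) refl (suc m) (m C k) x (m C suc k) ⟩
    suc m * ((m C k) + (m C suc k)) + x
      ≡⟨ cong (λ z → suc m * z + x) (nCk+nC[k+1]≡[n+1]C[k+1] m k) ⟩
    suc m * x + x
      ≡⟨ solve 2 (λ n x → n :* x :+ x := (con 1 :+ n) :* x) refl (suc m) x ⟩
    suc (suc m) * x
      ∎
    where
    open ≡-Reasoning
    x = suc m C suc k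
    y = suc m C suc (suc k)

  n*nCk≡[1+k]*nC[1+k]+k*nCk : ∀ n k → n * (n C k) ≡ suc k * (n C suc k) + k * (n C k)
  n*nCk≡[1+k]*nC[1+k]+k*nCk zero    zero    = refl
  n*nCk≡[1+k]*nC[1+k]+k*nCk zero    (suc k) = sym (trans (cong (_+ suc k * 0) (*-zeroʳ (suc (suc k)))) (*-zeroʳ (suc k)))
  n*nCk≡[1+k]*nC[1+k]+k*nCk (suc m) zero    =
    sym (trans (+-identityʳ _) (trans (+-identityʳ _) (trans (nC1≡n (suc m)) (sym (*-identityʳ (suc m))))))
  n*nCk≡[1+k]*nC[1+k]+k*nCk (suc m) (suc k) = begin
    suc m * (suc m C suc k)
      ≡⟨ cong (suc m *_) (nCk+nC[k+1]≡[n+1]C[k+1] m k) ⟨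
    suc m * ((m C k) + (m C suc k))
      ≡⟨ *-distribˡ-+ (suc m) (m C k) (m C suc k) ⟩
    suc m * (m C k) + suc m * (m C suc k)
      ≡⟨ cong₂ _+_ ([1+k]*[1+n]C[1+k]≡[1+n]*nCk m k) ([1+k]*[1+n]C[1+k]≡[1+n]*nCk m (suc k)) ⟨
    suc k * (suc m C suc k) + suc (suc k) * (suc m C suc (suc k))
                                                     ≡⟨ +-comm (suc k * (suc m C suc k)) _ ⟩
    suc (suc k) * (suc m C suc (suc k)) + suc k * (suc m C suc k)
      ∎
    where open ≡-Reasoning

  [n∸k]*nCk≡[1+k]*nC[1+k] : ∀ n k → (n ∸ k) * (n C k) ≡ suc k * (n C suc k)
  [n∸k]*nCk≡[1+k]*nC[1+k] n k = begin
    (n ∸ k) * (n C k)                                  ≡⟨ *-distribʳ-∸ (n C k) n k ⟩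
    n * (n C k) ∸ k * (n C k)                          ≡⟨ cong (_∸ k * (n C k)) (n*nCk≡[1+k]*nC[1+k]+k*nCk n k) ⟩
    suc k * (n C suc k) + k * (n C k) ∸ k * (n C k)    ≡⟨ m+n∸n≡m (suc k * (n C suc k)) (k * (n C k)) ⟩
    suc k * (n C suc k)                                ∎
    where open ≡-Reasoning

module PolynomialsA where

  open import Data.Nat using (ℕ; zero; suc; _+_; _*_; _∸_; _<_; _<?_; pred; s≤s)
  open import Data.Nat.Properties using (*-identityʳ; *-zeroʳ; *-distribʳ-+; *-assoc; n≤1+n; m≤n⇒m≤1+n; m<n⇒m<1+n; ≮⇒≥; pred[m∸n]≡m∸[1+n])
  open import Data.Nat.Combinatorics using (_C_; nC1≡n; k>n⇒nCk≡0; nCk+nC[k+1]≡[n+1]C[k+1])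
  open import Data.Nat.Solver using (module +-*-Solver)
  open +-*-Solver using (solve; _:+_; _:*_; _:=_; con)
  open import Relation.Nullary using (yes; no)
  open import Relation.Binary.PropositionalEquality using (_≡_; refl; sym; trans; cong; cong₂; module ≡-Reasoning)
  open Binomials
  open Involutions using (t-suc)
  open ℕSum

  shift : (ℕ → ℕ) → ℕ → ℕ
  shift f zero    = 0
  shift f (suc i) = f i

  A-suc : ∀ n i → A (suc n) i ≡ suc i * A n (suc i) + shift (A n) i + A n i
  A-suc n zero    = refl
  A-suc n (suc i) = refl

  A-vanishes : ∀ {n i} → n < i → A n i ≡ 0
  A-vanishes {zero}  {suc i} _ = refl
  A-vanishes {suc n} {suc i} (s≤s n<i) = begin
    suc (suc i) * A n (suc (suc i)) + A n i + A n (suc i)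
      ≡⟨ cong₂ _+_ (cong₂ _+_ (cong (suc (suc i) *_) (A-vanishes (m<n⇒m<1+n (m<n⇒m<1+n n<i)))) (A-vanishes n<i))
                   (A-vanishes (m<n⇒m<1+n n<i)) ⟩
    suc (suc i) * 0 + 0 + 0
      ≡⟨ cong (λ x → x + 0 + 0) (*-zeroʳ (suc (suc i))) ⟩
    0 ∎
    where open ≡-Reasoning

  -- The recurrence A (suc n) = A n ′ + (x + 1) A n, transposed to act on a sequence c.
  sumTo-A-suc : ∀ r (c : ℕ → ℕ) →
    sumToℕ (suc r) (λ i → A (suc r) i * c i) ≡ sumToℕ r (λ i → A r i * (c (suc i) + c i + i * c (pred i)))
  sumTo-A-suc r c = begin
    sumToℕ (suc r) (λ i → A (suc r) i * c i)
      ≡⟨ sumTo-cong (suc r) (λ i → trans (cong (_* c i) (A-suc r i)) (*-distribʳ-+₃ (suc i * A r (suc i)) (shift (A r) i) (A r i) (c i))) ⟩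
    sumToℕ (suc r) (λ i → suc i * A r (suc i) * c i + shift (A r) i * c i + A r i * c i)
      ≡⟨ sumTo-+₃ (suc r) (λ i → suc i * A r (suc i) * c i) (λ i → shift (A r) i * c i) (λ i → A r i * c i) ⟩
    sumToℕ (suc r) (λ i → suc i * A r (suc i) * c i) + sumToℕ (suc r) (λ i → shift (A r) i * c i) + sumToℕ (suc r) (λ i → A r i * c i)
      ≡⟨ cong₂ _+_ (cong₂ _+_ derivative-part shift-part) (sumTo-vanishing-tail _ (n≤1+n r) (λ i r<i → cong (_* c i) (A-vanishes r<i))) ⟩
    Σ-down + Σ-up + Σ-same
      ≡⟨ solve 3 (λ a b c → a :+ b :+ c := b :+ c :+ a) refl Σ-down Σ-up Σ-same ⟩
    Σ-up + Σ-same + Σ-down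
      ≡⟨ sumTo-+₃ r (λ i → A r i * c (suc i)) (λ i → A r i * c i) (λ i → A r i * (i * c (pred i))) ⟨
    sumToℕ r (λ i → A r i * c (suc i) + A r i * c i + A r i * (i * c (pred i)))
      ≡⟨ sumTo-cong r (λ i → sym (*-distribˡ-+₃ (A r i) (c (suc i)) (c i) (i * c (pred i)))) ⟩
    sumToℕ r (λ i → A r i * (c (suc i) + c i + i * c (pred i)))
      ∎
    where
    open ≡-Reasoning
    Σ-down = sumToℕ r (λ i → A r i * (i * c (pred i)))
    Σ-up   = sumToℕ r (λ i → A r i * c (suc i))
    Σ-same = sumToℕ r (λ i → A r i * c i)
    *-distribʳ-+₃ : ∀ x y z w → (x + y + z) * w ≡ x * w + y * w + z * w
    *-distribʳ-+₃ x y z w = solve 4 (λ x y z w → (x :+ y :+ z) :* w := x :* w :+ y :* w :+ z :* w) refl x y z w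
    *-distribˡ-+₃ : ∀ w x y z → w * (x + y + z) ≡ w * x + w * y + w * z
    *-distribˡ-+₃ w x y z = solve 4 (λ w x y z → w :* (x :+ y :+ z) := w :* x :+ w :* y :+ w :* z) refl w x y z
    sumTo-+₃ : ∀ k (f g h : ℕ → ℕ) → sumToℕ k (λ i → f i + g i + h i) ≡ sumToℕ k f + sumToℕ k g + sumToℕ k h
    sumTo-+₃ k f g h = trans (sumTo-distrib-+ k (λ i → f i + g i) h) (cong (_+ sumToℕ k h) (sumTo-distrib-+ k f g))
    derivative-part : sumToℕ (suc r) (λ i → suc i * A r (suc i) * c i) ≡ Σ-down
    derivative-part = begin
      sumToℕ (suc r) (λ i → suc i * A r (suc i) * c i)
        ≡⟨ sumTo-vanishing-tail _ (n≤1+n r) (λ { (suc i) (s≤s r≤i) → trans (cong (λ x → suc (suc i) * x * c (suc i)) (A-vanishes (s≤s (m≤n⇒m≤1+n r≤i))))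
                                                                            (cong (_* c (suc i)) (*-zeroʳ (suc (suc i)))) }) ⟩
      sumToℕ r (λ i → suc i * A r (suc i) * c i)
        ≡⟨ sumTo-cong r (λ i → solve 3 (λ j a x → (con 1 :+ j) :* a :* x := a :* ((con 1 :+ j) :* x)) refl i (A r (suc i)) (c i)) ⟩
      sumToℕ r (λ i → A r (suc i) * (suc i * c i))
        ≡⟨ cong (_+ sumToℕ r (λ i → A r (suc i) * (suc i * c i))) (*-zeroʳ (A r 0)) ⟨
      A r 0 * 0 + sumToℕ r (λ i → A r (suc i) * (suc i * c i))
        ≡⟨ sumTo-sucˡ r (λ i → A r i * (i * c (pred i))) ⟨
      sumToℕ (suc r) (λ i → A r i * (i * c (pred i)))
        ≡⟨ sumTo-vanishing-tail _ (n≤1+n r) (λ i r<i → cong (_* (i * c (pred i))) (A-vanishes r<i)) ⟩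
      Σ-down
        ∎
    shift-part : sumToℕ (suc r) (λ i → shift (A r) i * c i) ≡ Σ-up
    shift-part = sumTo-sucˡ r _

  ∸-suc-< : ∀ {j n} → j < n → n ∸ j ≡ suc (n ∸ suc j)
  ∸-suc-< {zero}  {suc n} _         = refl
  ∸-suc-< {suc j} {suc n} (s≤s j<n) = ∸-suc-< j<n

  nC[1+j]*t[n∸j]-split : ∀ n j → (n C suc j) * t (n ∸ j)
                     ≡ suc (suc j) * (n C suc (suc j)) * t (n ∸ suc (suc j)) + (n C suc j) * t (n ∸ suc j)
  nC[1+j]*t[n∸j]-split n j with j <? n
  ... | no j≮n rewrite k>n⇒nCk≡0 (s≤s (≮⇒≥ j≮n)) | k>n⇒nCk≡0 (m<n⇒m<1+n (s≤s (≮⇒≥ j≮n))) | *-zeroʳ (suc (suc j)) = refl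
  ... | yes j<n = begin
    C₁ * t (n ∸ j)
      ≡⟨ cong (λ m → C₁ * t m) (∸-suc-< j<n) ⟩
    C₁ * t (suc o)
      ≡⟨ cong (C₁ *_) (t-suc o) ⟩
    C₁ * (t o + o * t (pred o))
      ≡⟨ solve 4 (λ c x o y → c :* (x :+ o :* y) := o :* c :* y :+ c :* x) refl C₁ (t o) o (t (pred o)) ⟩
    o * C₁ * t (pred o) + C₁ * t o
      ≡⟨ cong₂ (λ x m → x * t m + C₁ * t o) ([n∸k]*nCk≡[1+k]*nC[1+k] n (suc j)) (pred[m∸n]≡m∸[1+n] n (suc j)) ⟩
    suc (suc j) * (n C suc (suc j)) * t (n ∸ suc (suc j)) + C₁ * t o
      ∎
    where
    open ≡-Reasoning
    C₁ = n C suc j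
    o = n ∸ suc j

  A-closed : ∀ n i → A n i ≡ (n C i) * t (n ∸ i)
  A-closed zero    zero    = refl
  A-closed zero    (suc i) = refl
  A-closed (suc n) zero    = begin
    1 * A n 1 + 0 + A n 0
      ≡⟨ cong₂ (λ x y → 1 * x + 0 + y) (A-closed n 1) (A-closed n 0) ⟩
    1 * ((n C 1) * t (n ∸ 1)) + 0 + 1 * t n
      ≡⟨ cong₂ (λ c m → 1 * (c * t m) + 0 + 1 * t n) (nC1≡n n) (sym (pred[m∸n]≡m∸[1+n] n 0)) ⟩
    1 * (n * t (pred n)) + 0 + 1 * t n
      ≡⟨ solve 2 (λ x y → con 1 :* x :+ con 0 :+ con 1 :* y := con 1 :* (y :+ x)) refl (n * t (pred n)) (t n) ⟩
    1 * (t n + n * t (pred n))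
      ≡⟨ cong (1 *_) (t-suc n) ⟨
    1 * t (suc n)
      ∎
    where open ≡-Reasoning
  A-closed (suc n) (suc j) = begin
    suc (suc j) * A n (suc (suc j)) + A n j + A n (suc j)
      ≡⟨ cong₂ _+_ (cong₂ _+_ (cong (suc (suc j) *_) (A-closed n (suc (suc j)))) (A-closed n j)) (A-closed n (suc j)) ⟩
    suc (suc j) * (C₂ * t (n ∸ suc (suc j))) + C₀ * t (n ∸ j) + C₁ * t (n ∸ suc j)
      ≡⟨ solve 6 (λ J c₂ t₂ c₀ t₀ r → J :* (c₂ :* t₂) :+ c₀ :* t₀ :+ r := c₀ :* t₀ :+ (J :* c₂ :* t₂ :+ r))
                 refl (suc (suc j)) C₂ (t (n ∸ suc (suc j))) C₀ (t (n ∸ j)) (C₁ * t (n ∸ suc j)) ⟩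
    C₀ * t (n ∸ j) + (suc (suc j) * C₂ * t (n ∸ suc (suc j)) + C₁ * t (n ∸ suc j))
      ≡⟨ cong (C₀ * t (n ∸ j) +_) (nC[1+j]*t[n∸j]-split n j) ⟨
    C₀ * t (n ∸ j) + C₁ * t (n ∸ j)
      ≡⟨ *-distribʳ-+ (t (n ∸ j)) C₀ C₁ ⟨
    (C₀ + C₁) * t (n ∸ j)
      ≡⟨ cong (_* t (n ∸ j)) (nCk+nC[k+1]≡[n+1]C[k+1] n j) ⟩
    (suc n C suc j) * t (n ∸ j)
      ∎
    where
    open ≡-Reasoning
    C₀ = n C j
    C₁ = n C suc j
    C₂ = n C suc (suc j)

  A-derivative : ∀ n i → suc i * A (suc n) (suc i) ≡ suc n * A n i
  A-derivative n i = begin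
    suc i * A (suc n) (suc i)                     ≡⟨ cong (suc i *_) (A-closed (suc n) (suc i)) ⟩
    suc i * ((suc n C suc i) * t (n ∸ i))         ≡⟨ *-assoc (suc i) (suc n C suc i) (t (n ∸ i)) ⟨
    suc i * (suc n C suc i) * t (n ∸ i)           ≡⟨ cong (_* t (n ∸ i)) ([1+k]*[1+n]C[1+k]≡[1+n]*nCk n i) ⟩
    suc n * (n C i) * t (n ∸ i)                   ≡⟨ *-assoc (suc n) (n C i) (t (n ∸ i)) ⟩
    suc n * ((n C i) * t (n ∸ i))                 ≡⟨ cong (suc n *_) (A-closed n i) ⟨
    suc n * A n i                                 ∎
    where open ≡-Reasoning

  A-total : ℕ → ℕ
  A-total n = sumToℕ n (A n)

  A-total-suc-suc : ∀ n → A-total (suc (suc n)) ≡ 2 * A-total (suc n) + suc n * A-total n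
  A-total-suc-suc n = begin
    sumToℕ (suc (suc n)) (A (suc (suc n)))
      ≡⟨ sumTo-cong (suc (suc n)) (λ i → sym (*-identityʳ (A (suc (suc n)) i))) ⟩
    sumToℕ (suc (suc n)) (λ i → A (suc (suc n)) i * 1)
      ≡⟨ sumTo-A-suc (suc n) (λ _ → 1) ⟩
    sumToℕ (suc n) (λ i → A (suc n) i * (1 + 1 + i * 1))
      ≡⟨ sumTo-cong (suc n) (λ i → solve 2 (λ a i → a :* (con 1 :+ con 1 :+ i :* con 1) := con 2 :* a :+ i :* a) refl (A (suc n) i) i) ⟩
    sumToℕ (suc n) (λ i → 2 * A (suc n) i + i * A (suc n) i)
      ≡⟨ trans (sumTo-distrib-+ (suc n) _ _) (cong (_+ sumToℕ (suc n) (λ i → i * A (suc n) i)) (sumTo-*ˡ (suc n) 2 (A (suc n)))) ⟩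
    2 * A-total (suc n) + sumToℕ (suc n) (λ i → i * A (suc n) i)
      ≡⟨ cong (2 * A-total (suc n) +_) derivative-at-1 ⟩
    2 * A-total (suc n) + suc n * A-total n
      ∎
    where
    open ≡-Reasoning
    derivative-at-1 : sumToℕ (suc n) (λ i → i * A (suc n) i) ≡ suc n * A-total n
    derivative-at-1 = begin
      sumToℕ (suc n) (λ i → i * A (suc n) i)          ≡⟨ sumTo-sucˡ n _ ⟩
      sumToℕ n (λ i → suc i * A (suc n) (suc i))      ≡⟨ sumTo-cong n (A-derivative n) ⟩
      sumToℕ n (λ i → suc n * A n i)                  ≡⟨ sumTo-*ˡ n (suc n) (A n) ⟩
      suc n * A-total n                               ∎

module YoungLattice where

  open import Data.Nat using (ℕ; zero; suc; _+_; _*_; _∸_; _≤_; _<_; _≤?_; _≤ᵇ_; pred; z≤n; s≤s; s≤s⁻¹)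
  open import Data.Nat.Properties using (+-comm; +-identityʳ; *-identityʳ; *-zeroʳ; *-distribˡ-+; ≤-refl; ≤-trans; n≤1+n; m≤n⇒m≤1+n; ≤-antisym; m≤m+n; m≤n+m; m+n∸n≡m; ≤⇒≤ᵇ)
  open import Data.Nat.ListAction using (sum)
  open import Data.Nat.Solver using (module +-*-Solver)
  open +-*-Solver using (solve; _:+_; _:*_; _:=_; con)
  open import Data.List using (List; []; _∷_; map; filter)
  open import Data.List.Properties using (filter-all)
  open import Data.List.Membership.Propositional using (_∈_)
  open import Data.List.Membership.Propositional.Properties using (∈-map⁻; ∈-filter⁻)
  open import Data.List.Relation.Unary.All as All using ()
  open import Data.List.Relation.Unary.Any using (here; there)
  open import Data.Product using (_×_; _,_; proj₁)
  open import Data.Unit using (⊤; tt)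
  open import Data.Bool using (true)
  open import Function using (_∘_)
  open import Relation.Nullary using (¬_; yes; no)
  open import Relation.Nullary.Negation using (contradiction)
  open import Relation.Binary.PropositionalEquality using (_≡_; refl; sym; trans; cong; cong₂; subst; module ≡-Reasoning)
  open ListSums

  IsPartition : List ℕ → Set
  IsPartition []      = ⊤
  IsPartition (a ∷ ρ) = 1 ≤ a × headOr0 ρ ≤ a × IsPartition ρ

  addablesUnder : ℕ → List ℕ → List (List ℕ)
  addablesUnder b ρ = filter (λ μ → headOr0 μ ≤? b) (addables ρ)

  -- Deletes the last cell of the first row a (a = 0 is junk).
  decHead : ℕ → List ℕ → List ℕ
  decHead zero          ρ = ρ
  decHead (suc zero)    ρ = ρ
  decHead (suc (suc a)) ρ = suc a ∷ ρ

  decHead-suc : ∀ {a} σ → 1 ≤ a → decHead (suc a) σ ≡ a ∷ σ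
  decHead-suc σ (s≤s z≤n) = refl

  removables : List ℕ → List (List ℕ)
  removables []      = []
  removables (a ∷ ρ) with suc (headOr0 ρ) ≤? a
  ... | yes _ = decHead a ρ ∷ map (a ∷_) (removables ρ)
  ... | no _  = map (a ∷_) (removables ρ)

  𝟙[_<_] : ℕ → ℕ → ℕ
  𝟙[ h < b ] with suc h ≤? b
  ... | yes _ = 1
  ... | no _  = 0

  𝟙-yes : ∀ {h b} → h < b → 𝟙[ h < b ] ≡ 1
  𝟙-yes {h} {b} h<b with suc h ≤? b
  ... | yes _   = refl
  ... | no h≮b = contradiction h<b h≮b

  𝟙-no : ∀ {h b} → ¬ h < b → 𝟙[ h < b ] ≡ 0
  𝟙-no {h} {b} h≮b with suc h ≤? b
  ... | yes h<b = contradiction h<b h≮b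
  ... | no _    = refl

  ∑-removables-∷ : ∀ a ν (F : List ℕ → ℕ) →
    ∑ (removables (a ∷ ν)) F ≡ 𝟙[ headOr0 ν < a ] * F (decHead a ν) + (∑[ μ ∈ removables ν ] F (a ∷ μ))
  ∑-removables-∷ a ν F with suc (headOr0 ν) ≤? a
  ... | yes _ = cong₂ _+_ (sym (+-identityʳ _)) (∑-map (a ∷_) (removables ν) F)
  ... | no _  = ∑-map (a ∷_) (removables ν) F

  ∑-filter-map-∷ : ∀ {a b} νs (G : List ℕ → ℕ) → a ≤ b →
    ∑ (filter (λ μ → headOr0 μ ≤? b) (map (a ∷_) νs)) G ≡ ∑[ ν ∈ νs ] G (a ∷ ν)
  ∑-filter-map-∷ {a} {b} νs G a≤b =
    trans (cong (λ μs → ∑ μs G) (filter-all (λ μ → headOr0 μ ≤? b) (All.tabulate head≤b))) (∑-map (a ∷_) νs G)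
    where
    head≤b : ∀ {μ} → μ ∈ map (a ∷_) νs → headOr0 μ ≤ b
    head≤b μ∈ with ∈-map⁻ (a ∷_) μ∈
    ... | _ , _ , refl = a≤b

  ∑-addablesUnder-∷ : ∀ {a b} σ (G : List ℕ → ℕ) → a ≤ b →
    ∑ (addablesUnder b (a ∷ σ)) G ≡ 𝟙[ a < b ] * G (suc a ∷ σ) + (∑[ ν ∈ addablesUnder a σ ] G (a ∷ ν))
  ∑-addablesUnder-∷ {a} {b} σ G a≤b with suc a ≤? b
  ... | yes a<b = trans (∑-filter-accept (λ μ → headOr0 μ ≤? b) G (suc a ∷ σ) (map (a ∷_) (addablesUnder a σ)) a<b)
                        (cong₂ _+_ (sym (+-identityʳ _)) (∑-filter-map-∷ (addablesUnder a σ) G a≤b))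
  ... | no a≮b  = trans (∑-filter-reject (λ μ → headOr0 μ ≤? b) G (suc a ∷ σ) (map (a ∷_) (addablesUnder a σ)) a≮b)
                        (∑-filter-map-∷ (addablesUnder a σ) G a≤b)

  addables-head-≥ : ∀ ρ {ν} → ν ∈ addables ρ → headOr0 ρ ≤ headOr0 ν
  addables-head-≥ []      (here refl) = z≤n
  addables-head-≥ (a ∷ σ) (here refl) = n≤1+n a
  addables-head-≥ (a ∷ σ) (there ν∈) with ∈-map⁻ (a ∷_) ν∈
  ... | _ , _ , refl = ≤-refl

  addables-head-≤ : ∀ ρ {ν} → ν ∈ addables ρ → headOr0 ν ≤ suc (headOr0 ρ)
  addables-head-≤ []      (here refl) = s≤s z≤n
  addables-head-≤ (a ∷ σ) (here refl) = ≤-refl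
  addables-head-≤ (a ∷ σ) (there ν∈) with ∈-map⁻ (a ∷_) ν∈
  ... | _ , _ , refl = n≤1+n a

  removables-head-≤ : ∀ ρ {μ} → μ ∈ removables ρ → headOr0 μ ≤ headOr0 ρ
  removables-head-≤ (a ∷ σ) μ∈ with suc (headOr0 σ) ≤? a
  removables-head-≤ (suc zero ∷ σ)    (here refl) | yes h<a = ≤-trans (n≤1+n _) h<a
  removables-head-≤ (suc (suc a) ∷ σ) (here refl) | yes _   = n≤1+n (suc a)
  removables-head-≤ (a ∷ σ) (there μ∈) | yes _ with ∈-map⁻ (a ∷_) μ∈
  ... | _ , _ , refl = ≤-refl
  removables-head-≤ (a ∷ σ) μ∈ | no _ with ∈-map⁻ (a ∷_) μ∈
  ... | _ , _ , refl = ≤-refl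

  addables-isPartition : ∀ ρ {ν} → IsPartition ρ → ν ∈ addables ρ → IsPartition ν
  addables-isPartition []      _ (here refl) = s≤s z≤n , z≤n , tt
  addables-isPartition (a ∷ σ) (1≤a , h≤a , σ-partition) (here refl) = s≤s z≤n , m≤n⇒m≤1+n h≤a , σ-partition
  addables-isPartition (a ∷ σ) (1≤a , _ , σ-partition) (there ν∈) with ∈-map⁻ (a ∷_) ν∈
  ... | μ , μ∈ , refl with ∈-filter⁻ (λ μ → headOr0 μ ≤? a) {xs = addables σ} μ∈
  ...   | μ∈addables , hμ≤a = 1≤a , hμ≤a , addables-isPartition σ σ-partition μ∈addables

  removables-isPartition : ∀ ρ {μ} → IsPartition ρ → μ ∈ removables ρ → IsPartition μ
  removables-isPartition (a ∷ σ) ρ-partition μ∈ with suc (headOr0 σ) ≤? a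
  removables-isPartition (suc zero ∷ σ)    (_ , _ , σ-partition) (here refl) | yes _ = σ-partition
  removables-isPartition (suc (suc a) ∷ σ) (_ , _ , σ-partition) (here refl) | yes h<a = s≤s z≤n , s≤s⁻¹ h<a , σ-partition
  removables-isPartition (a ∷ σ) (1≤a , h≤a , σ-partition) (there μ∈) | yes _ with ∈-map⁻ (a ∷_) μ∈
  ... | μ′ , μ′∈ , refl = 1≤a , ≤-trans (removables-head-≤ σ μ′∈) h≤a , removables-isPartition σ σ-partition μ′∈
  removables-isPartition (a ∷ σ) (1≤a , h≤a , σ-partition) μ∈ | no _ with ∈-map⁻ (a ∷_) μ∈
  ... | μ′ , μ′∈ , refl = 1≤a , ≤-trans (removables-head-≤ σ μ′∈) h≤a , removables-isPartition σ σ-partition μ′∈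

  ∑-filter-𝟙 : ∀ c νs (G : List ℕ → ℕ) →
    ∑[ ν ∈ filter (λ μ → headOr0 μ ≤? suc c) νs ] 𝟙[ headOr0 ν < suc c ] * G ν ≡ ∑ (filter (λ μ → headOr0 μ ≤? c) νs) G
  ∑-filter-𝟙 c [] G = refl
  ∑-filter-𝟙 c (ν ∷ νs) G with headOr0 ν ≤? c | headOr0 ν ≤? suc c
  ... | yes h≤c | yes h≤1+c = begin
    ∑[ ν ∈ filter (λ μ → headOr0 μ ≤? suc c) (ν ∷ νs) ] 𝟙[ headOr0 ν < suc c ] * G ν
      ≡⟨ ∑-filter-accept (λ μ → headOr0 μ ≤? suc c) (λ ν → 𝟙[ headOr0 ν < suc c ] * G ν) ν νs h≤1+c ⟩
    𝟙[ headOr0 ν < suc c ] * G ν + (∑[ ν ∈ filter (λ μ → headOr0 μ ≤? suc c) νs ] 𝟙[ headOr0 ν < suc c ] * G ν)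
      ≡⟨ cong₂ _+_ (trans (cong (_* G ν) (𝟙-yes (s≤s h≤c))) (+-identityʳ _)) (∑-filter-𝟙 c νs G) ⟩
    G ν + ∑ (filter (λ μ → headOr0 μ ≤? c) νs) G
      ≡⟨ ∑-filter-accept (λ μ → headOr0 μ ≤? c) G ν νs h≤c ⟨
    ∑ (filter (λ μ → headOr0 μ ≤? c) (ν ∷ νs)) G
      ∎
    where open ≡-Reasoning
  ... | yes h≤c | no h≰1+c = contradiction (m≤n⇒m≤1+n h≤c) h≰1+c
  ... | no h≰c  | yes h≤1+c = begin
    ∑[ ν ∈ filter (λ μ → headOr0 μ ≤? suc c) (ν ∷ νs) ] 𝟙[ headOr0 ν < suc c ] * G ν
      ≡⟨ ∑-filter-accept (λ μ → headOr0 μ ≤? suc c) (λ ν → 𝟙[ headOr0 ν < suc c ] * G ν) ν νs h≤1+c ⟩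
    𝟙[ headOr0 ν < suc c ] * G ν + (∑[ ν ∈ filter (λ μ → headOr0 μ ≤? suc c) νs ] 𝟙[ headOr0 ν < suc c ] * G ν)
      ≡⟨ cong₂ _+_ (cong (_* G ν) (𝟙-no (h≰c ∘ s≤s⁻¹))) (∑-filter-𝟙 c νs G) ⟩
    ∑ (filter (λ μ → headOr0 μ ≤? c) νs) G
      ≡⟨ ∑-filter-reject (λ μ → headOr0 μ ≤? c) G ν νs h≰c ⟨
    ∑ (filter (λ μ → headOr0 μ ≤? c) (ν ∷ νs)) G
      ∎
    where open ≡-Reasoning
  ... | no h≰c  | no h≰1+c =
    trans (∑-filter-reject (λ μ → headOr0 μ ≤? suc c) _ ν νs h≰1+c)
          (trans (∑-filter-𝟙 c νs G) (sym (∑-filter-reject (λ μ → headOr0 μ ≤? c) G ν νs h≰c)))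

  down : (List ℕ → ℕ) → List ℕ → ℕ
  down F ν = ∑ (removables ν) F

  isPartition-head-0 : ∀ {σ} → IsPartition σ → headOr0 σ ≡ 0 → σ ≡ []
  isPartition-head-0 {[]} _ _ = refl
  isPartition-head-0 {suc _ ∷ _} _ ()

  -- Adding a cell and then deleting the end of the first row agrees with deleting first and adding
  -- afterwards, except for the one term where the added cell is the deleted one.
  firstRow-commute : ∀ {a b} σ (F : List ℕ → ℕ) → 1 ≤ a → a ≤ b → IsPartition σ →
    (∑[ ν ∈ addablesUnder a σ ] 𝟙[ headOr0 ν < a ] * F (decHead a ν)) + 𝟙[ headOr0 σ < a ] * F (a ∷ σ)
      ≡ 𝟙[ headOr0 σ < a ] * ∑ (addablesUnder b (decHead a σ)) F
  firstRow-commute {a} {b} σ F 1≤a a≤b σ-partition with suc (headOr0 σ) ≤? a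
  ... | no h≮a = trans (+-identityʳ _) (∑-zeros (addablesUnder a σ) (λ {ν} ν∈ → cong (_* F (decHead a ν)) (𝟙-no (h≮a ∘ head-mono ν∈))))
    where
    head-mono : ∀ {ν} → ν ∈ addablesUnder a σ → headOr0 ν < a → headOr0 σ < a
    head-mono ν∈ = ≤-trans (s≤s (addables-head-≥ σ (proj₁ (∈-filter⁻ (λ μ → headOr0 μ ≤? a) {xs = addables σ} ν∈))))
  firstRow-commute {suc zero} {b} σ F _ 1≤b σ-partition | yes h<1 with isPartition-head-0 σ-partition (≤-antisym (s≤s⁻¹ h<1) z≤n)
  ... | refl = begin
    0 + 1 * F (1 ∷ [])                        ≡⟨ +-identityʳ _ ⟩
    F (1 ∷ [])                                ≡⟨ +-identityʳ _ ⟨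
    F (1 ∷ []) + ∑ [] F                       ≡⟨ ∑-filter-accept (λ μ → headOr0 μ ≤? b) F (1 ∷ []) [] 1≤b ⟨
    ∑ (addablesUnder b []) F                  ≡⟨ +-identityʳ _ ⟨
    1 * ∑ (addablesUnder b []) F              ∎
    where open ≡-Reasoning
  firstRow-commute {suc (suc c)} {b} σ F _ a≤b σ-partition | yes _ = begin
    (∑[ ν ∈ addablesUnder (suc (suc c)) σ ] 𝟙[ headOr0 ν < suc (suc c) ] * F (suc c ∷ ν)) + (F (suc (suc c) ∷ σ) + 0)
      ≡⟨ cong₂ _+_ (∑-filter-𝟙 (suc c) (addables σ) (λ ν → F (suc c ∷ ν))) (+-identityʳ _) ⟩
    (∑[ ν ∈ addablesUnder (suc c) σ ] F (suc c ∷ ν)) + F (suc (suc c) ∷ σ)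
      ≡⟨ +-comm (∑[ ν ∈ addablesUnder (suc c) σ ] F (suc c ∷ ν)) _ ⟩
    F (suc (suc c) ∷ σ) + (∑[ ν ∈ addablesUnder (suc c) σ ] F (suc c ∷ ν))
      ≡⟨ cong (_+ (∑[ ν ∈ addablesUnder (suc c) σ ] F (suc c ∷ ν))) (sym (trans (cong (_* F (suc (suc c) ∷ σ)) (𝟙-yes a≤b)) (+-identityʳ _))) ⟩
    𝟙[ suc c < b ] * F (suc (suc c) ∷ σ) + (∑[ ν ∈ addablesUnder (suc c) σ ] F (suc c ∷ ν))
      ≡⟨ ∑-addablesUnder-∷ σ F (≤-trans (n≤1+n _) a≤b) ⟨
    ∑ (addablesUnder b (suc c ∷ σ)) F
      ≡⟨ +-identityʳ _ ⟨
    1 * ∑ (addablesUnder b (suc c ∷ σ)) F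
      ∎
    where open ≡-Reasoning

  -- addables (a ∷ ρ) grows the lower rows through addablesUnder a ρ, so the induction needs the bound b.
  down-up-under : ∀ ρ {b} → IsPartition ρ → headOr0 ρ ≤ b → (F : List ℕ → ℕ) →
    ∑ (addablesUnder b ρ) (down F) ≡ (∑[ μ ∈ removables ρ ] ∑ (addablesUnder b μ) F) + 𝟙[ headOr0 ρ < b ] * F ρ
  down-up-under [] {b} _ _ F with 1 ≤? b
  ... | yes 1≤b = trans (∑-filter-accept (λ μ → headOr0 μ ≤? b) (down F) (1 ∷ []) [] 1≤b) (+-identityʳ _)
  ... | no 1≰b  = ∑-filter-reject (λ μ → headOr0 μ ≤? b) (down F) (1 ∷ []) [] 1≰b
  down-up-under (a ∷ σ) {b} (1≤a , h≤a , σ-partition) a≤b F = begin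
    ∑ (addablesUnder b (a ∷ σ)) (down F)
      ≡⟨ ∑-addablesUnder-∷ σ (down F) a≤b ⟩
    𝟙[ a < b ] * down F (suc a ∷ σ) + (∑[ ν ∈ addablesUnder a σ ] down F (a ∷ ν))
      ≡⟨ cong₂ _+_ (trans (cong (𝟙[ a < b ] *_) down-first) (*-distribˡ-+ 𝟙[ a < b ] _ _)) down-rest ⟩
    (p + r) + (Y + (Z + u))
      ≡⟨ solve 5 (λ p r Y Z u → (p :+ r) :+ (Y :+ (Z :+ u)) := ((Y :+ u) :+ (r :+ Z)) :+ p) refl p r Y Z u ⟩
    ((Y + u) + (r + Z)) + p
      ≡⟨ cong₂ (λ l r → (l + r) + p) (firstRow-commute σ F 1≤a a≤b σ-partition) (sym up-rest) ⟩
    (𝟙[ headOr0 σ < a ] * ∑ (addablesUnder b (decHead a σ)) F + (∑[ μ ∈ removables σ ] ∑ (addablesUnder b (a ∷ μ)) F)) + p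
      ≡⟨ cong (_+ p) (∑-removables-∷ a σ (λ μ → ∑ (addablesUnder b μ) F)) ⟨
    (∑[ μ ∈ removables (a ∷ σ) ] ∑ (addablesUnder b μ) F) + 𝟙[ a < b ] * F (a ∷ σ)
      ∎
    where
    open ≡-Reasoning
    F₀ F₁ : List ℕ → ℕ
    F₀ μ = F (a ∷ μ)
    F₁ μ = F (suc a ∷ μ)
    p = 𝟙[ a < b ] * F (a ∷ σ)
    r = 𝟙[ a < b ] * down F₁ σ
    Y = ∑[ ν ∈ addablesUnder a σ ] 𝟙[ headOr0 ν < a ] * F (decHead a ν)
    Z = ∑[ μ ∈ removables σ ] ∑ (addablesUnder a μ) F₀
    u = 𝟙[ headOr0 σ < a ] * F₀ σ
    down-first : down F (suc a ∷ σ) ≡ F (a ∷ σ) + down F₁ σ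
    down-first = trans (∑-removables-∷ (suc a) σ F)
                   (cong (_+ down F₁ σ) (trans (cong (_* F (decHead (suc a) σ)) (𝟙-yes (s≤s h≤a))) (trans (+-identityʳ _) (cong F (decHead-suc σ 1≤a)))))
    down-rest : (∑[ ν ∈ addablesUnder a σ ] down F (a ∷ ν)) ≡ Y + (Z + u)
    down-rest = trans (∑-cong (addablesUnder a σ) (λ {ν} _ → ∑-removables-∷ a ν F))
                  (trans (∑-distrib-+ (addablesUnder a σ) _ _) (cong (Y +_) (down-up-under σ σ-partition h≤a F₀)))
    up-rest : (∑[ μ ∈ removables σ ] ∑ (addablesUnder b (a ∷ μ)) F) ≡ r + Z
    up-rest = trans (∑-cong (removables σ) (λ {μ} _ → ∑-addablesUnder-∷ μ F a≤b))
                (trans (∑-distrib-+ (removables σ) _ _) (cong (_+ Z) (∑-*ˡ (removables σ) 𝟙[ a < b ] F₁)))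

  count-addablesUnder : ∀ ρ {b} → IsPartition ρ → headOr0 ρ ≤ b →
    (∑[ ν ∈ addablesUnder b ρ ] 1) ≡ (∑[ μ ∈ removables ρ ] 1) + 𝟙[ headOr0 ρ < b ]
  count-addablesUnder [] {b} _ _ with 1 ≤? b
  ... | yes 1≤b = ∑-filter-accept (λ μ → headOr0 μ ≤? b) (λ _ → 1) (1 ∷ []) [] 1≤b
  ... | no 1≰b  = ∑-filter-reject (λ μ → headOr0 μ ≤? b) (λ _ → 1) (1 ∷ []) [] 1≰b
  count-addablesUnder (a ∷ σ) {b} (_ , h≤a , σ-partition) a≤b = begin
    (∑[ ν ∈ addablesUnder b (a ∷ σ) ] 1)
      ≡⟨ ∑-addablesUnder-∷ σ (λ _ → 1) a≤b ⟩
    𝟙[ a < b ] * 1 + (∑[ ν ∈ addablesUnder a σ ] 1)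
      ≡⟨ cong₂ _+_ (*-identityʳ 𝟙[ a < b ]) (count-addablesUnder σ σ-partition h≤a) ⟩
    𝟙[ a < b ] + ((∑[ μ ∈ removables σ ] 1) + 𝟙[ headOr0 σ < a ])
      ≡⟨ solve 3 (λ x y z → x :+ (y :+ z) := (z :+ y) :+ x) refl 𝟙[ a < b ] (∑[ μ ∈ removables σ ] 1) 𝟙[ headOr0 σ < a ] ⟩
    (𝟙[ headOr0 σ < a ] + (∑[ μ ∈ removables σ ] 1)) + 𝟙[ a < b ]
      ≡⟨ cong (λ x → (x + (∑[ μ ∈ removables σ ] 1)) + 𝟙[ a < b ]) (*-identityʳ 𝟙[ headOr0 σ < a ]) ⟨
    (𝟙[ headOr0 σ < a ] * 1 + (∑[ μ ∈ removables σ ] 1)) + 𝟙[ a < b ]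
      ≡⟨ cong (_+ 𝟙[ a < b ]) (∑-removables-∷ a σ (λ _ → 1)) ⟨
    (∑[ μ ∈ removables (a ∷ σ) ] 1) + 𝟙[ a < b ]
      ∎
    where open ≡-Reasoning

  addablesUnder-head : ∀ μ {c} → headOr0 μ ≤ c → addablesUnder (suc c) μ ≡ addables μ
  addablesUnder-head μ h≤c = filter-all (λ ν → headOr0 ν ≤? _) (All.tabulate (λ ν∈ → ≤-trans (addables-head-≤ μ ν∈) (s≤s h≤c)))

  down-up : ∀ α → IsPartition α → (F : List ℕ → ℕ) →
    ∑ (addables α) (down F) ≡ (∑[ μ ∈ removables α ] ∑ (addables μ) F) + F α
  down-up α α-partition F = begin
    ∑ (addables α) (down F)
      ≡⟨ cong (λ νs → ∑ νs (down F)) (addablesUnder-head α ≤-refl) ⟨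
    ∑ (addablesUnder (suc (headOr0 α)) α) (down F)
      ≡⟨ down-up-under α α-partition (n≤1+n _) F ⟩
    (∑[ μ ∈ removables α ] ∑ (addablesUnder (suc (headOr0 α)) μ) F) + 𝟙[ headOr0 α < suc (headOr0 α) ] * F α
      ≡⟨ cong₂ _+_ (∑-cong (removables α) (λ {μ} μ∈ → cong (λ νs → ∑ νs F) (addablesUnder-head μ (removables-head-≤ α μ∈))))
                   (trans (cong (_* F α) (𝟙-yes {headOr0 α} ≤-refl)) (+-identityʳ (F α))) ⟩
    (∑[ μ ∈ removables α ] ∑ (addables μ) F) + F α
      ∎
    where open ≡-Reasoning

  count-addables : ∀ α → IsPartition α → (∑[ ν ∈ addables α ] 1) ≡ (∑[ μ ∈ removables α ] 1) + 1
  count-addables α α-partition = begin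
    (∑[ ν ∈ addables α ] 1)                                             ≡⟨ cong (λ νs → ∑ νs (λ _ → 1)) (addablesUnder-head α ≤-refl) ⟨
    (∑[ ν ∈ addablesUnder (suc (headOr0 α)) α ] 1)                       ≡⟨ count-addablesUnder α α-partition (n≤1+n _) ⟩
    (∑[ μ ∈ removables α ] 1) + 𝟙[ headOr0 α < suc (headOr0 α) ]         ≡⟨ cong ((∑[ μ ∈ removables α ] 1) +_) (𝟙-yes {headOr0 α} ≤-refl) ⟩
    (∑[ μ ∈ removables α ] 1) + 1                                       ∎
    where open ≡-Reasoning

  downChains : List ℕ → ℕ → ℕ
  downChains α zero    = 1
  downChains α (suc i) = down (λ μ → downChains μ i) α

  -- The Weyl-algebra relation D U = U D + 1 of Young's lattice, iterated: D^i U = U D^i + i D^(i-1).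
  up-downChains : ∀ α i → IsPartition α →
    (∑[ ν ∈ addables α ] downChains ν i) ≡ downChains α (suc i) + downChains α i + i * downChains α (pred i)
  up-downChains α zero α-partition = trans (count-addables α α-partition) (sym (+-identityʳ _))
  up-downChains α (suc j) α-partition = begin
    ∑ (addables α) (down (λ μ → downChains μ j))
      ≡⟨ down-up α α-partition (λ μ → downChains μ j) ⟩
    (∑[ μ ∈ removables α ] ∑[ ν ∈ addables μ ] downChains ν j) + downChains α j
      ≡⟨ cong (_+ downChains α j) (∑-cong (removables α) (λ μ∈ → up-downChains _ j (removables-isPartition α α-partition μ∈))) ⟩
    (∑[ μ ∈ removables α ] (downChains μ (suc j) + downChains μ j + j * downChains μ (pred j))) + downChains α j
      ≡⟨ cong (_+ downChains α j) (trans (∑-distrib-+ (removables α) _ _) (cong₂ _+_ (∑-distrib-+ (removables α) _ _) (∑-*ˡ (removables α) j _))) ⟩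
    downChains α (suc (suc j)) + downChains α (suc j) + j * down (λ μ → downChains μ (pred j)) α + downChains α j
      ≡⟨ cong (λ x → downChains α (suc (suc j)) + downChains α (suc j) + x + downChains α j) (lower j) ⟩
    downChains α (suc (suc j)) + downChains α (suc j) + j * downChains α j + downChains α j
      ≡⟨ solve 4 (λ a b j r → a :+ b :+ j :* r :+ r := a :+ b :+ (con 1 :+ j) :* r) refl
                 (downChains α (suc (suc j))) (downChains α (suc j)) j (downChains α j) ⟩
    downChains α (suc (suc j)) + downChains α (suc j) + suc j * downChains α j
      ∎
    where
    open ≡-Reasoning
    lower : ∀ j → j * down (λ μ → downChains μ (pred j)) α ≡ j * downChains α j
    lower zero    = refl
    lower (suc j) = refl

  chains-expansion : ∀ r α → IsPartition α → chains α r ≡ sumToℕ r (λ i → A r i * downChains α i)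
  chains-expansion zero α _ = refl
  chains-expansion (suc r) α α-partition = begin
    (∑[ ν ∈ addables α ] chains ν r)
      ≡⟨ ∑-cong (addables α) (λ ν∈ → chains-expansion r _ (addables-isPartition α α-partition ν∈)) ⟩
    (∑[ ν ∈ addables α ] sumToℕ r (λ i → A r i * downChains ν i))
      ≡⟨ ∑-sumTo (addables α) r (A r) (λ ν i → downChains ν i) ⟩
    sumToℕ r (λ i → A r i * (∑[ ν ∈ addables α ] downChains ν i))
      ≡⟨ ℕSum.sumTo-cong r (λ i → cong (A r i *_) (up-downChains α i α-partition)) ⟩
    sumToℕ r (λ i → A r i * (downChains α (suc i) + downChains α i + i * downChains α (pred i)))
      ≡⟨ PolynomialsA.sumTo-A-suc r (downChains α) ⟨
    sumToℕ (suc r) (λ i → A (suc r) i * downChains α i)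
      ∎
    where open ≡-Reasoning

  removables-row : ∀ k → removables (rowPart (suc k)) ≡ rowPart k ∷ []
  removables-row zero    = refl
  removables-row (suc k) = refl

  downChains-row-≤ : ∀ {i k} → i ≤ k → downChains (rowPart k) i ≡ 1
  downChains-row-≤ {zero}          _         = refl
  downChains-row-≤ {suc i} {suc k} (s≤s i≤k) =
    trans (cong (λ μs → ∑ μs (λ μ → downChains μ i)) (removables-row k)) (trans (+-identityʳ _) (downChains-row-≤ i≤k))

  downChains-row-> : ∀ {i k} → k < i → downChains (rowPart k) i ≡ 0
  downChains-row-> {suc i} {zero}  _         = refl
  downChains-row-> {suc i} {suc k} (s≤s k<i) =
    trans (cong (λ μs → ∑ μs (λ μ → downChains μ i)) (removables-row k)) (trans (+-identityʳ _) (downChains-row-> k<i))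

  chains-row : ∀ n k → chains (rowPart k) n ≡ sumToℕ k (A n)
  chains-row n k = begin
    chains (rowPart k) n
      ≡⟨ chains-expansion n (rowPart k) (rowPart-isPartition k) ⟩
    sumToℕ n (λ i → A n i * downChains (rowPart k) i)
      ≡⟨ sumTo-vanishing-tail _ (m≤m+n n k) (λ i n<i → cong (_* _) (PolynomialsA.A-vanishes n<i)) ⟨
    sumToℕ (n + k) (λ i → A n i * downChains (rowPart k) i)
      ≡⟨ sumTo-vanishing-tail _ (m≤n+m k n) (λ i k<i → trans (cong (A n i *_) (downChains-row-> k<i)) (*-zeroʳ (A n i))) ⟩
    sumToℕ k (λ i → A n i * downChains (rowPart k) i)
      ≡⟨ sumTo-cong-≤ k (λ i i≤k → trans (cong (A n i *_) (downChains-row-≤ i≤k)) (*-identityʳ (A n i))) ⟩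
    sumToℕ k (A n)
      ∎
    where
    open ≡-Reasoning
    open ℕSum
    rowPart-isPartition : ∀ k → IsPartition (rowPart k)
    rowPart-isPartition zero    = tt
    rowPart-isPartition (suc k) = s≤s z≤n , z≤n , tt

  N-≤ : ∀ {m} α → sum α ≤ m → N m α ≡ chains α (m ∸ sum α)
  N-≤ {m} α |α|≤m with sum α ≤ᵇ m | ≤⇒≤ᵇ |α|≤m
  ... | true | _ = refl

  Nrow≡sumA : ∀ n k → Nrow (n + k) k ≡ sumToℕ k (A n)
  Nrow≡sumA n k = begin
    N (n + k) (rowPart k)                   ≡⟨ N-≤ (rowPart k) (subst (_≤ n + k) (sym (sum-rowPart k)) (m≤n+m k n)) ⟩
    chains (rowPart k) (n + k ∸ sum (rowPart k)) ≡⟨ cong (λ s → chains (rowPart k) (n + k ∸ s)) (sum-rowPart k) ⟩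
    chains (rowPart k) (n + k ∸ k)          ≡⟨ cong (chains (rowPart k)) (m+n∸n≡m n k) ⟩
    chains (rowPart k) n                    ≡⟨ chains-row n k ⟩
    sumToℕ k (A n)                          ∎
    where
    open ≡-Reasoning
    sum-rowPart : ∀ k → sum (rowPart k) ≡ k
    sum-rowPart zero    = refl
    sum-rowPart (suc k) = cong suc (+-identityʳ k)

module Casts where

  open import Data.Nat as ℕ using (ℕ; zero; suc; _!; NonZero)
  import Data.Nat.Properties as ℕ
  import Data.Integer as ℤ
  import Data.Integer.Properties as ℤ
  import Data.Integer.Solver as ℤ-Solver
  open import Data.Rational as ℚ using (1ℚ; _+_; _*_; _/_; toℚᵘ)
  open import Data.Rational.Properties as ℚ using (toℚᵘ-injective; toℚᵘ-homo-+; toℚᵘ-homo-*; normalize-coprime)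
  open import Data.Rational.Unnormalised as ℚᵘ using (mkℚᵘ; *≡*)
  import Data.Rational.Unnormalised.Properties as ℚᵘ
  open import Data.Nat.Coprimality using (1-coprimeTo)
  import Data.Nat.Coprimality as Coprime
  open import Relation.Binary.PropositionalEquality using (_≡_; refl; sym; trans; cong; cong₂; module ≡-Reasoning)

  -- Identities about ℕtoℚ of a variable are checked in ℚᵘ, where nothing gets normalised.
  toℚᵘ-ℕtoℚ : ∀ n → toℚᵘ (ℕtoℚ n) ≡ mkℚᵘ (ℤ.+ n) 0
  toℚᵘ-ℕtoℚ n = cong toℚᵘ (normalize-coprime {n} {0} (Coprime.sym (1-coprimeTo n)))

  ℕtoℚ-suc : ∀ n → ℕtoℚ (suc n) ≡ 1ℚ + ℕtoℚ n
  ℕtoℚ-suc n = toℚᵘ-injective (begin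
    toℚᵘ (ℕtoℚ (suc n))               ≡⟨ toℚᵘ-ℕtoℚ (suc n) ⟩
    mkℚᵘ (ℤ.+ suc n) 0                   ≈⟨ *≡* (trans (cong (ℤ._* (ℤ.+ 1 ℤ.* ℤ.+ 1)) (ℤ.pos-+ 1 n)) (ℤ-identity (ℤ.+ n))) ⟩
    mkℚᵘ (ℤ.+ 1) 0 ℚᵘ.+ mkℚᵘ (ℤ.+ n) 0     ≡⟨ cong (mkℚᵘ (ℤ.+ 1) 0 ℚᵘ.+_) (toℚᵘ-ℕtoℚ n) ⟨
    toℚᵘ 1ℚ ℚᵘ.+ toℚᵘ (ℕtoℚ n)          ≈⟨ toℚᵘ-homo-+ 1ℚ (ℕtoℚ n) ⟨
    toℚᵘ (1ℚ + ℕtoℚ n)                 ∎)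
    where
    open ℚᵘ.≃-Reasoning
    open ℤ-Solver.+-*-Solver
    ℤ-identity = solve 1 (λ x → (con (ℤ.+ 1) :+ x) :* (con (ℤ.+ 1) :* con (ℤ.+ 1))
                             := (con (ℤ.+ 1) :* con (ℤ.+ 1) :+ x :* con (ℤ.+ 1)) :* con (ℤ.+ 1)) refl

  ℕtoℚ-+ : ∀ m n → ℕtoℚ (m ℕ.+ n) ≡ ℕtoℚ m + ℕtoℚ n
  ℕtoℚ-+ zero    n = sym (ℚ.+-identityˡ (ℕtoℚ n))
  ℕtoℚ-+ (suc m) n = begin
    ℕtoℚ (suc (m ℕ.+ n))         ≡⟨ ℕtoℚ-suc (m ℕ.+ n) ⟩
    1ℚ + ℕtoℚ (m ℕ.+ n)          ≡⟨ cong (1ℚ +_) (ℕtoℚ-+ m n) ⟩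
    1ℚ + (ℕtoℚ m + ℕtoℚ n)       ≡⟨ ℚ.+-assoc 1ℚ (ℕtoℚ m) (ℕtoℚ n) ⟨
    (1ℚ + ℕtoℚ m) + ℕtoℚ n       ≡⟨ cong (_+ ℕtoℚ n) (ℕtoℚ-suc m) ⟨
    ℕtoℚ (suc m) + ℕtoℚ n        ∎
    where open ≡-Reasoning

  ℕtoℚ-* : ∀ m n → ℕtoℚ (m ℕ.* n) ≡ ℕtoℚ m * ℕtoℚ n
  ℕtoℚ-* zero    n = sym (ℚ.*-zeroˡ (ℕtoℚ n))
  ℕtoℚ-* (suc m) n = begin
    ℕtoℚ (n ℕ.+ m ℕ.* n)               ≡⟨ ℕtoℚ-+ n (m ℕ.* n) ⟩
    ℕtoℚ n + ℕtoℚ (m ℕ.* n)            ≡⟨ cong₂ _+_ (sym (ℚ.*-identityˡ (ℕtoℚ n))) (ℕtoℚ-* m n) ⟩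
    1ℚ * ℕtoℚ n + ℕtoℚ m * ℕtoℚ n      ≡⟨ ℚ.*-distribʳ-+ (ℕtoℚ n) 1ℚ (ℕtoℚ m) ⟨
    (1ℚ + ℕtoℚ m) * ℕtoℚ n             ≡⟨ cong (_* ℕtoℚ n) (ℕtoℚ-suc m) ⟨
    ℕtoℚ (suc m) * ℕtoℚ n              ∎
    where open ≡-Reasoning

  ℕtoℚ-sumTo : ∀ k (g : ℕ → ℕ) → ℕtoℚ (sumToℕ k g) ≡ sumToℚ k (λ i → ℕtoℚ (g i))
  ℕtoℚ-sumTo zero    g = refl
  ℕtoℚ-sumTo (suc k) g = trans (ℕtoℚ-+ (sumToℕ k g) (g (suc k))) (cong (_+ ℕtoℚ (g (suc k))) (ℕtoℚ-sumTo k g))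

  ℕtoℚ-*-inverse : ∀ m .{{_ : NonZero m}} → ℕtoℚ m * (ℤ.+ 1 / m) ≡ 1ℚ
  ℕtoℚ-*-inverse (suc d) = toℚᵘ-injective (begin
    toℚᵘ (ℕtoℚ (suc d) * (ℤ.+ 1 / suc d))
      ≈⟨ toℚᵘ-homo-* (ℕtoℚ (suc d)) (ℤ.+ 1 / suc d) ⟩
    toℚᵘ (ℕtoℚ (suc d)) ℚᵘ.* toℚᵘ (ℤ.+ 1 / suc d)
      ≡⟨ cong₂ ℚᵘ._*_ (toℚᵘ-ℕtoℚ (suc d)) (cong toℚᵘ (normalize-coprime {1} {d} (1-coprimeTo (suc d)))) ⟩
    mkℚᵘ (ℤ.+ suc d) 0 ℚᵘ.* mkℚᵘ (ℤ.+ 1) d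
      ≈⟨ *≡* (ℤ-identity (ℤ.+ suc d)) ⟩
    toℚᵘ 1ℚ
      ∎)
    where
    open ℚᵘ.≃-Reasoning
    open ℤ-Solver.+-*-Solver
    ℤ-identity = solve 1 (λ x → (x :* con (ℤ.+ 1)) :* con (ℤ.+ 1) := con (ℤ.+ 1) :* (con (ℤ.+ 1) :* x)) refl

  ℕtoℚ-!-*-inv! : ∀ n → ℕtoℚ (n !) * inv! n ≡ 1ℚ
  ℕtoℚ-!-*-inv! n = ℕtoℚ-*-inverse (n !) {{n ℕ.!≢0}}

  ℕtoℚ-suc-*-inv! : ∀ n → ℕtoℚ (suc n) * inv! (suc n) ≡ inv! n
  ℕtoℚ-suc-*-inv! n = begin
    x                                  ≡⟨ ℚ.*-identityˡ x ⟨
    1ℚ * x                             ≡⟨ cong (_* x) (trans (ℚ.*-comm (inv! n) (ℕtoℚ (n !))) (ℕtoℚ-!-*-inv! n)) ⟨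
    (inv! n * ℕtoℚ (n !)) * x          ≡⟨ ℚ.*-assoc (inv! n) (ℕtoℚ (n !)) x ⟩
    inv! n * (ℕtoℚ (n !) * x)          ≡⟨ cong (inv! n *_) n!*x≡1 ⟩
    inv! n * 1ℚ                        ≡⟨ ℚ.*-identityʳ (inv! n) ⟩
    inv! n                             ∎
    where
    open ≡-Reasoning
    x = ℕtoℚ (suc n) * inv! (suc n)
    n!*x≡1 : ℕtoℚ (n !) * x ≡ 1ℚ
    n!*x≡1 = begin
      ℕtoℚ (n !) * (ℕtoℚ (suc n) * inv! (suc n))
        ≡⟨ ℚ.*-assoc (ℕtoℚ (n !)) (ℕtoℚ (suc n)) (inv! (suc n)) ⟨
      (ℕtoℚ (n !) * ℕtoℚ (suc n)) * inv! (suc n)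
        ≡⟨ cong (_* inv! (suc n)) (trans (ℚ.*-comm (ℕtoℚ (n !)) (ℕtoℚ (suc n))) (sym (ℕtoℚ-* (suc n) (n !)))) ⟩
      ℕtoℚ (suc n !) * inv! (suc n)
        ≡⟨ ℕtoℚ-!-*-inv! (suc n) ⟩
      1ℚ
        ∎

module PowerSeries where

  open import Data.Nat as ℕ using (ℕ; zero; suc; _∸_; _≤_; _<_; z≤n; s≤s)
  import Data.Nat.Properties as ℕ
  import Data.Integer as ℤ
  open import Data.Rational as ℚ using (ℚ; 0ℚ; 1ℚ; _+_; _*_; _/_)
  import Data.Rational.Properties as ℚ
  open import Data.Rational.Solver using (module +-*-Solver)
  open +-*-Solver using (solve; _:+_; _:*_; _:=_; con)
  open import Algebra.Bundles using (CommutativeRing)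
  open import Relation.Binary.PropositionalEquality using (_≡_; refl; sym; trans; cong; cong₂; module ≡-Reasoning)

  open Casts

  module ℚSum = FiniteSums (CommutativeRing.commutativeSemiring ℚ.+-*-commutativeRing) sumToℚ (λ _ → refl) (λ _ _ → refl)
  open ℚSum public

  D : FPSℚ → FPSℚ
  D f n = ℕtoℚ (suc n) * f (suc n)

  D-cong : ∀ {f g} → f ≋ g → D f ≋ D g
  D-cong f≋g n = cong (ℕtoℚ (suc n) *_) (f≋g (suc n))

  D-⋆ : ∀ f g → D (f ⋆ g) ≋ (λ n → (D f ⋆ g) n + (f ⋆ D g) n)
  D-⋆ f g n = begin
    ℕtoℚ (suc n) * sumToℚ (suc n) term
      ≡⟨ sumTo-*ˡ (suc n) (ℕtoℚ (suc n)) term ⟨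
    sumToℚ (suc n) (λ i → ℕtoℚ (suc n) * term i)
      ≡⟨ sumTo-cong-≤ (suc n) (λ i i≤1+n → split-weight i≤1+n) ⟩
    sumToℚ (suc n) (λ i → ℕtoℚ i * term i + ℕtoℚ (suc n ∸ i) * term i)
      ≡⟨ sumTo-distrib-+ (suc n) (λ i → ℕtoℚ i * term i) (λ i → ℕtoℚ (suc n ∸ i) * term i) ⟩
    sumToℚ (suc n) (λ i → ℕtoℚ i * term i) + sumToℚ (suc n) (λ i → ℕtoℚ (suc n ∸ i) * term i)
      ≡⟨ cong₂ _+_ left right ⟩
    (D f ⋆ g) n + (f ⋆ D g) n
      ∎
    where
    open ≡-Reasoning
    term : ℕ → ℚ
    term i = f i * g (suc n ∸ i)
    split-weight : ∀ {i} → i ≤ suc n → ℕtoℚ (suc n) * term i ≡ ℕtoℚ i * term i + ℕtoℚ (suc n ∸ i) * term i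
    split-weight {i} i≤1+n = begin
      ℕtoℚ (suc n) * term i                         ≡⟨ cong (λ m → ℕtoℚ m * term i) (ℕ.m+[n∸m]≡n i≤1+n) ⟨
      ℕtoℚ (i ℕ.+ (suc n ∸ i)) * term i             ≡⟨ cong (_* term i) (ℕtoℚ-+ i (suc n ∸ i)) ⟩
      (ℕtoℚ i + ℕtoℚ (suc n ∸ i)) * term i          ≡⟨ ℚ.*-distribʳ-+ (term i) (ℕtoℚ i) (ℕtoℚ (suc n ∸ i)) ⟩
      ℕtoℚ i * term i + ℕtoℚ (suc n ∸ i) * term i   ∎
    left : sumToℚ (suc n) (λ i → ℕtoℚ i * term i) ≡ (D f ⋆ g) n
    left = begin
      sumToℚ (suc n) (λ i → ℕtoℚ i * term i)
        ≡⟨ sumTo-sucˡ n (λ i → ℕtoℚ i * term i) ⟩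
      0ℚ * term 0 + sumToℚ n (λ i → ℕtoℚ (suc i) * (f (suc i) * g (n ∸ i)))
        ≡⟨ cong₂ _+_ (ℚ.*-zeroˡ (term 0)) (sumTo-cong n (λ i → sym (ℚ.*-assoc (ℕtoℚ (suc i)) (f (suc i)) (g (n ∸ i))))) ⟩
      0ℚ + (D f ⋆ g) n
        ≡⟨ ℚ.+-identityˡ _ ⟩
      (D f ⋆ g) n
        ∎
    right : sumToℚ (suc n) (λ i → ℕtoℚ (suc n ∸ i) * term i) ≡ (f ⋆ D g) n
    right = begin
      sumToℚ n (λ i → ℕtoℚ (suc n ∸ i) * term i) + ℕtoℚ (n ∸ n) * term (suc n)
        ≡⟨ cong (λ m → sumToℚ n (λ i → ℕtoℚ (suc n ∸ i) * term i) + ℕtoℚ m * (f (suc n) * g m)) (ℕ.n∸n≡0 n) ⟩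
      sumToℚ n (λ i → ℕtoℚ (suc n ∸ i) * term i) + 0ℚ * (f (suc n) * g 0)
        ≡⟨ trans (cong (sumToℚ n (λ i → ℕtoℚ (suc n ∸ i) * term i) +_) (ℚ.*-zeroˡ (f (suc n) * g 0))) (ℚ.+-identityʳ _) ⟩
      sumToℚ n (λ i → ℕtoℚ (suc n ∸ i) * term i)
        ≡⟨ sumTo-cong-≤ n (λ i i≤n → trans (cong (λ m → ℕtoℚ m * (f i * g m)) (ℕ.+-∸-assoc 1 i≤n))
                                         (solve 3 (λ c a b → c :* (a :* b) := a :* (c :* b)) refl (ℕtoℚ (suc (n ∸ i))) (f i) (g (suc (n ∸ i))))) ⟩
      (f ⋆ D g) n
        ∎

  D-constant : ∀ {g} → D g ≋ (λ _ → 0ℚ) → ∀ m → g (suc m) ≡ 0ℚ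
  D-constant {g} Dg≋0 m = begin
    g (suc m)                                          ≡⟨ ℚ.*-identityˡ (g (suc m)) ⟨
    1ℚ * g (suc m)                                     ≡⟨ cong (_* g (suc m)) (trans (ℚ.*-comm r (ℕtoℚ (suc m))) (ℕtoℚ-*-inverse (suc m))) ⟨
    r * ℕtoℚ (suc m) * g (suc m)                       ≡⟨ ℚ.*-assoc r (ℕtoℚ (suc m)) (g (suc m)) ⟩
    r * D g m                                          ≡⟨ cong (r *_) (Dg≋0 m) ⟩
    r * 0ℚ                                             ≡⟨ ℚ.*-zeroʳ r ⟩
    0ℚ                                                 ∎
    where
    open ≡-Reasoning
    r = ℤ.+ 1 / suc m

  oneℚ-⋆ : ∀ g → oneℚ ⋆ g ≋ g
  oneℚ-⋆ = ⋆-identityˡ {oneℚ} refl (λ _ → refl)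

  linear : ℚ → ℚ → FPSℚ
  linear a b zero          = a
  linear a b (suc zero)    = b
  linear a b (suc (suc _)) = 0ℚ

  linear-⋆ : ∀ a b g m → (linear a b ⋆ g) (suc m) ≡ a * g (suc m) + b * g m
  linear-⋆ a b g m = sumTo-vanishing-tail {k = 1} {l = suc m} (λ i → linear a b i * g (suc m ∸ i)) (s≤s z≤n) beyond-linear
    where
    beyond-linear : ∀ i → 1 ℕ.< i → linear a b i * g (suc m ∸ i) ≡ 0ℚ
    beyond-linear (suc (suc i)) _ = ℚ.*-zeroˡ (g (m ∸ suc i))
    beyond-linear (suc zero) (s≤s ())

  module Exponential (f : FPSℚ) (f₀≡0 : f 0 ≡ 0ℚ) where

    powℚ-vanishes : ∀ {n j} → j < n → powℚ f n j ≡ 0ℚ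
    powℚ-vanishes {suc n} {j} j<1+n = sumTo-zeros j term
      where
      term : ∀ i → i ≤ j → f i * powℚ f n (j ∸ i) ≡ 0ℚ
      term zero    _   = trans (cong (_* powℚ f n j) f₀≡0) (ℚ.*-zeroˡ (powℚ f n j))
      term (suc i) i<j = trans (cong (f (suc i) *_) (powℚ-vanishes (shrink i<j j<1+n))) (ℚ.*-zeroʳ (f (suc i)))
        where
        shrink : ∀ {i j} → suc i ≤ j → j < suc n → j ∸ suc i < n
        shrink {i} {suc j} _ (s≤s j<n) = ℕ.≤-<-trans (ℕ.m∸n≤m j i) j<n

    D-powℚ : ∀ n → D (powℚ f (suc n)) ≋ (λ m → ℕtoℚ (suc n) * (D f ⋆ powℚ f n) m)
    D-powℚ zero m = begin
      ℕtoℚ (suc m) * (f ⋆ oneℚ) (suc m)   ≡⟨ cong (ℕtoℚ (suc m) *_) (trans (⋆-comm f oneℚ (suc m)) (oneℚ-⋆ f (suc m))) ⟩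
      D f m                               ≡⟨ oneℚ-⋆ (D f) m ⟨
      (oneℚ ⋆ D f) m                      ≡⟨ ⋆-comm oneℚ (D f) m ⟩
      (D f ⋆ oneℚ) m                      ≡⟨ ℚ.*-identityˡ _ ⟨
      1ℚ * (D f ⋆ oneℚ) m                 ∎
      where open ≡-Reasoning
    D-powℚ (suc n) m = begin
      D (f ⋆ powℚ f (suc n)) m
        ≡⟨ D-⋆ f (powℚ f (suc n)) m ⟩
      X + (f ⋆ D (powℚ f (suc n))) m
        ≡⟨ cong (X +_) (⋆-congˡ f (D-powℚ n) m) ⟩
      X + (f ⋆ (λ i → c * (D f ⋆ powℚ f n) i)) m
        ≡⟨ cong (X +_) (⋆-*ʳ c f (D f ⋆ powℚ f n) m) ⟩
      X + c * (f ⋆ (D f ⋆ powℚ f n)) m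
        ≡⟨ cong (λ y → X + c * y) (trans (⋆-comm-assoc (D f) f (powℚ f n) m) (⋆-assoc f (D f) (powℚ f n) m)) ⟨
      X + c * X
        ≡⟨ solve 2 (λ x c → x :+ c :* x := (con 1ℚ :+ c) :* x) refl X c ⟩
      (1ℚ + c) * X
        ≡⟨ cong (_* X) (ℕtoℚ-suc (suc n)) ⟨
      ℕtoℚ (suc (suc n)) * X
        ∎
      where
      open ≡-Reasoning
      c = ℕtoℚ (suc n)
      X = (D f ⋆ powℚ f (suc n)) m

    expℚ-truncated : ∀ {i j} → i ≤ j → sumToℚ j (λ n → inv! n * powℚ f n (j ∸ i)) ≡ expℚ f (j ∸ i)
    expℚ-truncated {i} {j} _ = sumTo-vanishing-tail (λ n → inv! n * powℚ f n (j ∸ i)) (ℕ.m∸n≤m j i)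
      (λ n j∸i<n → trans (cong (inv! n *_) (powℚ-vanishes j∸i<n)) (ℚ.*-zeroʳ (inv! n)))

    D-expℚ : D (expℚ f) ≋ D f ⋆ expℚ f
    D-expℚ j = begin
      ℕtoℚ (suc j) * sumToℚ (suc j) (λ n → inv! n * powℚ f n (suc j))
        ≡⟨ sumTo-*ˡ (suc j) (ℕtoℚ (suc j)) _ ⟨
      sumToℚ (suc j) (λ n → ℕtoℚ (suc j) * (inv! n * powℚ f n (suc j)))
        ≡⟨ sumTo-cong (suc j) (λ n → solve 3 (λ a b c → a :* (b :* c) := b :* (a :* c)) refl (ℕtoℚ (suc j)) (inv! n) (powℚ f n (suc j))) ⟩
      sumToℚ (suc j) (λ n → inv! n * D (powℚ f n) j)
        ≡⟨ sumTo-sucˡ j (λ n → inv! n * D (powℚ f n) j) ⟩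
      inv! 0 * D oneℚ j + sumToℚ j (λ n → inv! (suc n) * D (powℚ f (suc n)) j)
        ≡⟨ cong₂ _+_ (trans (cong (inv! 0 *_) (ℚ.*-zeroʳ (ℕtoℚ (suc j)))) (ℚ.*-zeroʳ (inv! 0))) (sumTo-cong j lower-power) ⟩
      0ℚ + sumToℚ j (λ n → inv! n * (D f ⋆ powℚ f n) j)
        ≡⟨ ℚ.+-identityˡ _ ⟩
      sumToℚ j (λ n → inv! n * sumToℚ j (λ i → D f i * powℚ f n (j ∸ i)))
        ≡⟨ sumTo-cong j (λ n → trans (sym (sumTo-*ˡ j (inv! n) _)) (sumTo-cong j (λ i →
             solve 3 (λ a b c → a :* (b :* c) := b :* (a :* c)) refl (inv! n) (D f i) (powℚ f n (j ∸ i))))) ⟩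
      sumToℚ j (λ n → sumToℚ j (λ i → D f i * (inv! n * powℚ f n (j ∸ i))))
        ≡⟨ sumTo-swap j j (λ n i → D f i * (inv! n * powℚ f n (j ∸ i))) ⟩
      sumToℚ j (λ i → sumToℚ j (λ n → D f i * (inv! n * powℚ f n (j ∸ i))))
        ≡⟨ sumTo-cong j (λ i → sumTo-*ˡ j (D f i) (λ n → inv! n * powℚ f n (j ∸ i))) ⟩
      sumToℚ j (λ i → D f i * sumToℚ j (λ n → inv! n * powℚ f n (j ∸ i)))
        ≡⟨ sumTo-cong-≤ j (λ i i≤j → cong (D f i *_) (expℚ-truncated i≤j)) ⟩
      (D f ⋆ expℚ f) j
        ∎
      where
      open ≡-Reasoning
      lower-power : ∀ n → inv! (suc n) * D (powℚ f (suc n)) j ≡ inv! n * (D f ⋆ powℚ f n) j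
      lower-power n = begin
        inv! (suc n) * D (powℚ f (suc n)) j
          ≡⟨ cong (inv! (suc n) *_) (D-powℚ n j) ⟩
        inv! (suc n) * (ℕtoℚ (suc n) * (D f ⋆ powℚ f n) j)
          ≡⟨ ℚ.*-assoc (inv! (suc n)) _ _ ⟨
        inv! (suc n) * ℕtoℚ (suc n) * (D f ⋆ powℚ f n) j
          ≡⟨ cong (_* (D f ⋆ powℚ f n) j) (trans (ℚ.*-comm (inv! (suc n)) _) (ℕtoℚ-suc-*-inv! n)) ⟩
        inv! n * (D f ⋆ powℚ f n) j
          ∎

module StableValues where

  open import Data.Nat as ℕ using (zero; suc; _≤_; _!)
  open import Data.Rational as ℚ using (1ℚ; _+_; _*_)
  import Data.Rational.Properties as ℚ
  open import Data.Rational.Solver using (module +-*-Solver)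
  open +-*-Solver using (solve; _:+_; _:*_; _:=_)
  open import Relation.Binary.PropositionalEquality using (_≡_; refl; trans; cong; cong₂; module ≡-Reasoning)
  open Casts
  open PowerSeries
  open PolynomialsA using (A-total; A-total-suc-suc)

  private
    E₂ : FPSℚ
    E₂ = expℚ halfU²2U

  D-halfU²2U : D halfU²2U ≋ linear (ℕtoℚ 2) 1ℚ
  D-halfU²2U zero          = refl
  D-halfU²2U (suc zero)    = refl
  D-halfU²2U (suc (suc m)) = ℚ.*-zeroʳ (ℕtoℚ (suc (suc (suc m))))

  E₂-suc-suc : ∀ m → ℕtoℚ (suc (suc m)) * E₂ (suc (suc m)) ≡ ℕtoℚ 2 * E₂ (suc m) + E₂ m
  E₂-suc-suc m = begin
    D E₂ (suc m)                                 ≡⟨ Exponential.D-expℚ halfU²2U refl (suc m) ⟩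
    (D halfU²2U ⋆ E₂) (suc m)                    ≡⟨ ⋆-congʳ E₂ D-halfU²2U (suc m) ⟩
    (linear (ℕtoℚ 2) 1ℚ ⋆ E₂) (suc m)            ≡⟨ linear-⋆ (ℕtoℚ 2) 1ℚ E₂ m ⟩
    ℕtoℚ 2 * E₂ (suc m) + 1ℚ * E₂ m              ≡⟨ cong (ℕtoℚ 2 * E₂ (suc m) +_) (ℚ.*-identityˡ (E₂ m)) ⟩
    ℕtoℚ 2 * E₂ (suc m) + E₂ m                   ∎
    where open ≡-Reasoning

  b-suc-suc : ∀ n → b (suc (suc n)) ≡ ℕtoℚ 2 * b (suc n) + ℕtoℚ (suc n) * b n
  b-suc-suc n = begin
    ℕtoℚ (suc (suc n) ℕ.* suc n !) * E₂ (suc (suc n))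
      ≡⟨ cong (_* E₂ (suc (suc n))) (trans (ℕtoℚ-* (suc (suc n)) (suc n !)) (ℚ.*-comm (ℕtoℚ (suc (suc n))) (ℕtoℚ (suc n !)))) ⟩
    ℕtoℚ (suc n !) * ℕtoℚ (suc (suc n)) * E₂ (suc (suc n))
      ≡⟨ ℚ.*-assoc (ℕtoℚ (suc n !)) (ℕtoℚ (suc (suc n))) (E₂ (suc (suc n))) ⟩
    ℕtoℚ (suc n !) * (ℕtoℚ (suc (suc n)) * E₂ (suc (suc n)))
      ≡⟨ cong (ℕtoℚ (suc n !) *_) (E₂-suc-suc n) ⟩
    ℕtoℚ (suc n !) * (ℕtoℚ 2 * E₂ (suc n) + E₂ n)
      ≡⟨ cong (λ x → x * (ℕtoℚ 2 * E₂ (suc n) + E₂ n)) (ℕtoℚ-* (suc n) (n !)) ⟩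
    ℕtoℚ (suc n) * ℕtoℚ (n !) * (ℕtoℚ 2 * E₂ (suc n) + E₂ n)
      ≡⟨ solve 5 (λ s f g x y → s :* f :* (g :* x :+ y) := g :* (s :* f :* x) :+ s :* (f :* y)) refl
                 (ℕtoℚ (suc n)) (ℕtoℚ (n !)) (ℕtoℚ 2) (E₂ (suc n)) (E₂ n) ⟩
    ℕtoℚ 2 * (ℕtoℚ (suc n) * ℕtoℚ (n !) * E₂ (suc n)) + ℕtoℚ (suc n) * b n
      ≡⟨ cong (λ x → ℕtoℚ 2 * (x * E₂ (suc n)) + ℕtoℚ (suc n) * b n) (ℕtoℚ-* (suc n) (n !)) ⟨
    ℕtoℚ 2 * b (suc n) + ℕtoℚ (suc n) * b n
      ∎
    where open ≡-Reasoning

  b≡A-total : ∀ n → b n ≡ ℕtoℚ (A-total n)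
  b≡A-total zero          = refl
  b≡A-total (suc zero)    = refl
  b≡A-total (suc (suc n)) = begin
    b (suc (suc n))
      ≡⟨ b-suc-suc n ⟩
    ℕtoℚ 2 * b (suc n) + ℕtoℚ (suc n) * b n
      ≡⟨ cong₂ (λ x y → ℕtoℚ 2 * x + ℕtoℚ (suc n) * y) (b≡A-total (suc n)) (b≡A-total n) ⟩
    ℕtoℚ 2 * ℕtoℚ (A-total (suc n)) + ℕtoℚ (suc n) * ℕtoℚ (A-total n)
      ≡⟨ cong₂ _+_ (ℕtoℚ-* 2 (A-total (suc n))) (ℕtoℚ-* (suc n) (A-total n)) ⟨
    ℕtoℚ (2 ℕ.* A-total (suc n)) + ℕtoℚ (suc n ℕ.* A-total n)
      ≡⟨ ℕtoℚ-+ (2 ℕ.* A-total (suc n)) (suc n ℕ.* A-total n) ⟨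
    ℕtoℚ (2 ℕ.* A-total (suc n) ℕ.+ suc n ℕ.* A-total n)
      ≡⟨ cong ℕtoℚ (A-total-suc-suc n) ⟨
    ℕtoℚ (A-total (suc (suc n)))
      ∎
    where open ≡-Reasoning

  Nrow≡b : ∀ n k → n ≤ k → ℕtoℚ (Nrow (n ℕ.+ k) k) ≡ b n
  Nrow≡b n k n≤k = begin
    ℕtoℚ (Nrow (n ℕ.+ k) k)  ≡⟨ cong ℕtoℚ (YoungLattice.Nrow≡sumA n k) ⟩
    ℕtoℚ (sumToℕ k (A n))    ≡⟨ cong ℕtoℚ (ℕSum.sumTo-vanishing-tail (A n) n≤k (λ i → PolynomialsA.A-vanishes)) ⟩
    ℕtoℚ (A-total n)         ≡⟨ b≡A-total n ⟨
    b n                      ∎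
    where open ≡-Reasoning

module QExpansion where

  open import Data.Nat as ℕ using (ℕ; zero; suc; _∸_; _≤_)
  import Data.Nat.Properties as ℕ
  open import Data.Rational as ℚ using (ℚ; 0ℚ; 1ℚ; _+_; _*_; -_)
  import Data.Rational.Properties as ℚ
  open import Data.Rational.Solver using (module +-*-Solver)
  open +-*-Solver using (solve; _:+_; _:*_; _:=_; con; :-_)
  open import Relation.Binary.PropositionalEquality using (_≡_; refl; sym; trans; cong; cong₂; module ≡-Reasoning; _→-setoid_)
  open Casts
  open PowerSeries
  open Involutions using (t-suc)

  -- T n is the n-th derivative of the exponential generating function of the t m.
  T : ℕ → FPSℚ
  T n m = ℕtoℚ (t (n ℕ.+ m)) * inv! m

  Aℚ : ℕ → FPSℚ
  Aℚ n i = ℕtoℚ (A n i)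

  onePlusX : FPSℚ
  onePlusX = linear 1ℚ 1ℚ

  T-suc : ∀ n → T (suc n) ≋ D (T n)
  T-suc n m = begin
    ℕtoℚ (t (suc n ℕ.+ m)) * inv! m
      ≡⟨ cong (λ k → ℕtoℚ (t k) * inv! m) (ℕ.+-suc n m) ⟨
    ℕtoℚ (t (n ℕ.+ suc m)) * inv! m
      ≡⟨ cong (ℕtoℚ (t (n ℕ.+ suc m)) *_) (ℕtoℚ-suc-*-inv! m) ⟨
    ℕtoℚ (t (n ℕ.+ suc m)) * (ℕtoℚ (suc m) * inv! (suc m))
      ≡⟨ solve 3 (λ x y z → x :* (y :* z) := y :* (x :* z)) refl (ℕtoℚ (t (n ℕ.+ suc m))) (ℕtoℚ (suc m)) (inv! (suc m)) ⟩
    D (T n) m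
      ∎
    where open ≡-Reasoning

  D-T0 : D (T 0) ≋ onePlusX ⋆ T 0
  D-T0 zero    = refl
  D-T0 (suc j) = begin
    ℕtoℚ (suc (suc j)) * (ℕtoℚ (t (suc (suc j))) * inv! (suc (suc j)))
      ≡⟨ solve 3 (λ x y z → x :* (y :* z) := y :* (x :* z)) refl (ℕtoℚ (suc (suc j))) (ℕtoℚ (t (suc (suc j)))) (inv! (suc (suc j))) ⟩
    ℕtoℚ (t (suc (suc j))) * (ℕtoℚ (suc (suc j)) * inv! (suc (suc j)))
      ≡⟨ cong₂ (λ x y → ℕtoℚ x * y) (t-suc (suc j)) (ℕtoℚ-suc-*-inv! (suc j)) ⟩
    ℕtoℚ (t (suc j) ℕ.+ suc j ℕ.* t j) * inv! (suc j)
      ≡⟨ cong (_* inv! (suc j)) (trans (ℕtoℚ-+ (t (suc j)) (suc j ℕ.* t j)) (cong (ℕtoℚ (t (suc j)) +_) (ℕtoℚ-* (suc j) (t j)))) ⟩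
    (ℕtoℚ (t (suc j)) + ℕtoℚ (suc j) * ℕtoℚ (t j)) * inv! (suc j)
      ≡⟨ solve 4 (λ a s b i → (a :+ s :* b) :* i := con 1ℚ :* (a :* i) :+ con 1ℚ :* (b :* (s :* i))) refl
                 (ℕtoℚ (t (suc j))) (ℕtoℚ (suc j)) (ℕtoℚ (t j)) (inv! (suc j)) ⟩
    1ℚ * T 0 (suc j) + 1ℚ * (ℕtoℚ (t j) * (ℕtoℚ (suc j) * inv! (suc j)))
      ≡⟨ cong (λ x → 1ℚ * T 0 (suc j) + 1ℚ * (ℕtoℚ (t j) * x)) (ℕtoℚ-suc-*-inv! j) ⟩
    1ℚ * T 0 (suc j) + 1ℚ * T 0 j
      ≡⟨ linear-⋆ 1ℚ 1ℚ (T 0) j ⟨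
    (onePlusX ⋆ T 0) (suc j)
      ∎
    where open ≡-Reasoning

  Aℚ-suc : ∀ n → Aℚ (suc n) ≋ (λ i → D (Aℚ n) i + (onePlusX ⋆ Aℚ n) i)
  Aℚ-suc n i = begin
    ℕtoℚ (A (suc n) i)
      ≡⟨ cong ℕtoℚ (PolynomialsA.A-suc n i) ⟩
    ℕtoℚ (suc i ℕ.* A n (suc i) ℕ.+ PolynomialsA.shift (A n) i ℕ.+ A n i)
      ≡⟨ trans (ℕtoℚ-+ (suc i ℕ.* A n (suc i) ℕ.+ shifted-term) (A n i))
               (cong (_+ Aℚ n i) (trans (ℕtoℚ-+ (suc i ℕ.* A n (suc i)) shifted-term)
                                        (cong (_+ ℕtoℚ shifted-term) (ℕtoℚ-* (suc i) (A n (suc i)))))) ⟩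
    D (Aℚ n) i + ℕtoℚ (PolynomialsA.shift (A n) i) + Aℚ n i
      ≡⟨ ℚ.+-assoc (D (Aℚ n) i) (ℕtoℚ shifted-term) (Aℚ n i) ⟩
    D (Aℚ n) i + (ℕtoℚ (PolynomialsA.shift (A n) i) + Aℚ n i)
      ≡⟨ cong (D (Aℚ n) i +_) (shifted i) ⟩
    D (Aℚ n) i + (onePlusX ⋆ Aℚ n) i
      ∎
    where
    open ≡-Reasoning
    shifted-term = PolynomialsA.shift (A n) i
    shifted : ∀ i → ℕtoℚ (PolynomialsA.shift (A n) i) + Aℚ n i ≡ (onePlusX ⋆ Aℚ n) i
    shifted zero    = trans (ℚ.+-identityˡ (Aℚ n 0)) (sym (ℚ.*-identityˡ (Aℚ n 0)))
    shifted (suc j) = begin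
      Aℚ n j + Aℚ n (suc j)               ≡⟨ ℚ.+-comm (Aℚ n j) (Aℚ n (suc j)) ⟩
      Aℚ n (suc j) + Aℚ n j               ≡⟨ cong₂ _+_ (ℚ.*-identityˡ (Aℚ n (suc j))) (ℚ.*-identityˡ (Aℚ n j)) ⟨
      1ℚ * Aℚ n (suc j) + 1ℚ * Aℚ n j     ≡⟨ linear-⋆ 1ℚ 1ℚ (Aℚ n) j ⟨
      (onePlusX ⋆ Aℚ n) (suc j)           ∎

  T≋Aℚ⋆T0 : ∀ n → T n ≋ Aℚ n ⋆ T 0
  T≋Aℚ⋆T0 zero    = λ m → sym (⋆-identityˡ {Aℚ 0} refl (λ _ → refl) (T 0) m)
  T≋Aℚ⋆T0 (suc n) = begin
    T (suc n)
      ≈⟨ T-suc n ⟩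
    D (T n)
      ≈⟨ D-cong (T≋Aℚ⋆T0 n) ⟩
    D (Aℚ n ⋆ T 0)
      ≈⟨ D-⋆ (Aℚ n) (T 0) ⟩
    (λ m → (D (Aℚ n) ⋆ T 0) m + (Aℚ n ⋆ D (T 0)) m)
      ≈⟨ (λ m → cong ((D (Aℚ n) ⋆ T 0) m +_) (trans (⋆-congˡ (Aℚ n) D-T0 m) (⋆-comm-assoc (Aℚ n) onePlusX (T 0) m))) ⟩
    (λ m → (D (Aℚ n) ⋆ T 0) m + ((onePlusX ⋆ Aℚ n) ⋆ T 0) m)
      ≈⟨ ⋆-distribʳ-+ (D (Aℚ n)) (onePlusX ⋆ Aℚ n) (T 0) ⟨
    (λ i → D (Aℚ n) i + (onePlusX ⋆ Aℚ n) i) ⋆ T 0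
      ≈⟨ ⋆-congʳ (T 0) (Aℚ-suc n) ⟨
    Aℚ (suc n) ⋆ T 0
      ∎
    where open import Relation.Binary.Reasoning.Setoid (ℕ →-setoid ℚ)

  private
    E : FPSℚ
    E = expℚ negXHalfX²

  D-negXHalfX² : D negXHalfX² ≋ (λ m → - 1ℚ * onePlusX m)
  D-negXHalfX² zero          = refl
  D-negXHalfX² (suc zero)    = refl
  D-negXHalfX² (suc (suc m)) = trans (ℚ.*-zeroʳ (ℕtoℚ (suc (suc (suc m))))) (sym (ℚ.*-zeroʳ (- 1ℚ)))

  D-E : D E ≋ (λ m → - 1ℚ * (onePlusX ⋆ E) m)
  D-E m = trans (Exponential.D-expℚ negXHalfX² refl m) (trans (⋆-congʳ E D-negXHalfX² m) (⋆-*ˡ (- 1ℚ) onePlusX E m))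

  -- (E ⋆ T 0)′ = -(1 + x) E T 0 + E (1 + x) T 0 = 0.
  E⋆T0≋one : E ⋆ T 0 ≋ oneℚ
  E⋆T0≋one zero    = refl
  E⋆T0≋one (suc m) = D-constant {E ⋆ T 0} D[E⋆T0]≋0 m
    where
    D[E⋆T0]≋0 : D (E ⋆ T 0) ≋ (λ _ → 0ℚ)
    D[E⋆T0]≋0 j = begin
      D (E ⋆ T 0) j
        ≡⟨ D-⋆ E (T 0) j ⟩
      (D E ⋆ T 0) j + (E ⋆ D (T 0)) j
        ≡⟨ cong₂ _+_ (trans (⋆-congʳ (T 0) D-E j) (⋆-*ˡ (- 1ℚ) (onePlusX ⋆ E) (T 0) j))
                     (trans (⋆-congˡ E D-T0 j) (⋆-comm-assoc E onePlusX (T 0) j)) ⟩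
      - 1ℚ * Y + Y
        ≡⟨ solve 1 (λ y → (:- con 1ℚ) :* y :+ y := con 0ℚ) refl Y ⟩
      0ℚ
        ∎
      where
      open ≡-Reasoning
      Y = ((onePlusX ⋆ E) ⋆ T 0) j

  Nrow≡q-sum : ∀ n k → ℕtoℚ (Nrow (n ℕ.+ k) k) ≡ sumToℚ k (λ j → q j * inv! (k ∸ j) * ℕtoℚ (t (n ℕ.+ k ∸ j)))
  Nrow≡q-sum n k = sym (begin
    sumToℚ k (λ j → q j * inv! (k ∸ j) * ℕtoℚ (t (n ℕ.+ k ∸ j)))
      ≡⟨ sumTo-cong-≤ k (λ j j≤k → trans (cong (λ m → q j * inv! (k ∸ j) * ℕtoℚ (t m)) (ℕ.+-∸-assoc n j≤k))
                                          (x*y*z≡x*[z*y] (q j) (inv! (k ∸ j)) (ℕtoℚ (t (n ℕ.+ (k ∸ j)))))) ⟩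
    ((E ⋆ geomℚ) ⋆ T n) k
      ≡⟨ ⋆-congˡ (E ⋆ geomℚ) (T≋Aℚ⋆T0 n) k ⟩
    ((E ⋆ geomℚ) ⋆ (Aℚ n ⋆ T 0)) k
      ≡⟨ ⋆-swap E geomℚ (Aℚ n) (T 0) k ⟩
    ((E ⋆ T 0) ⋆ (Aℚ n ⋆ geomℚ)) k
      ≡⟨ ⋆-congʳ (Aℚ n ⋆ geomℚ) E⋆T0≋one k ⟩
    (oneℚ ⋆ (Aℚ n ⋆ geomℚ)) k
      ≡⟨ oneℚ-⋆ (Aℚ n ⋆ geomℚ) k ⟩
    sumToℚ k (λ i → Aℚ n i * 1ℚ)
      ≡⟨ sumTo-cong k (λ i → ℚ.*-identityʳ (Aℚ n i)) ⟩
    sumToℚ k (Aℚ n)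
      ≡⟨ ℕtoℚ-sumTo k (A n) ⟨
    ℕtoℚ (sumToℕ k (A n))
      ≡⟨ cong ℕtoℚ (YoungLattice.Nrow≡sumA n k) ⟨
    ℕtoℚ (Nrow (n ℕ.+ k) k)
      ∎)
    where
    open ≡-Reasoning
    x*y*z≡x*[z*y] : ∀ x y z → x * y * z ≡ x * (z * y)
    x*y*z≡x*[z*y] = solve 3 (λ x y z → x :* y :* z := x :* (z :* y)) refl

open import Data.Nat using (ℕ; _+_; _∸_; _≤_)
open import Data.Nat.Combinatorics using (_C_)
open import Data.Rational using (ℚ; _*_)
open import Data.Product using (_×_; _,_)
open import Relation.Binary.PropositionalEquality using (_≡_; trans; sym)
open import Data.Nat.Properties using (*-identityʳ)

corollary2p4 :
    ((n k : ℕ) →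
        (Nrow (n + k) k ≡ sumToℕ k (λ j → (n C j) Data.Nat.* t (n ∸ j)))
      × (ℕtoℚ (Nrow (n + k) k)
          ≡ sumToℚ k (λ j → q j * inv! (k ∸ j) * ℕtoℚ (t (n + k ∸ j)))))
    × ((n k : ℕ) → Nrow (n + k) k ≡ mulℕ (A n) geomℕ k)
    × ((n k : ℕ) → n ≤ k → ℕtoℚ (Nrow (n + k) k) ≡ b n)
corollary2p4 = (λ n k → Nrow≡binomial-sum n k , QExpansion.Nrow≡q-sum n k) , Nrow≡A⋆geom , StableValues.Nrow≡b
  where
  open YoungLattice using (Nrow≡sumA)

  Nrow≡binomial-sum : ∀ n k → Nrow (n + k) k ≡ sumToℕ k (λ j → (n C j) Data.Nat.* t (n ∸ j))
  Nrow≡binomial-sum n k = trans (Nrow≡sumA n k) (ℕSum.sumTo-cong k (PolynomialsA.A-closed n))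

  Nrow≡A⋆geom : ∀ n k → Nrow (n + k) k ≡ mulℕ (A n) geomℕ k
  Nrow≡A⋆geom n k = trans (Nrow≡sumA n k) (ℕSum.sumTo-cong k (λ i → sym (*-identityʳ (A n i))))
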